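{- (i) For all integers $2\leq k\leq n$, \[S_{n,k}=X_1\sum_{j=1}^{n-k+1}\binom{n-1}{j-1}S_{j,1}\,S_{n-j,k-1}.\] (ii) For all integers $1\leq k\leq n$, \[\widetilde{B}_{n,k}=\sum_{j=2}^{n-k+1}\binom{n-1}{j-1}X_j\,\widetilde{B}_{n-j,k-1}.\]
   Context: Let $R=\mathbb{Z}[X_1,X_1^{ -1},X_2,X_3,\ldots]$. Partial exponential Bell polynomials: $B_{0,0}=1$, $B_{n,0}=0$ for $n\geq1$, $B_{n,k}=0$ for $0\leq n<k$, and for $1\leq k\leq n$, $B_{n,k}=\sum \frac{n!}{r_1!\cdots r_{n-k+1}!\,(1!)^{r_1}\cdots((n-k+1)!)^{r_{n-k+1}}}X_1^{r_1}\cdots X_{n-k+1}^{r_{n-k+1}}$, summed over nonnegative integers $r_i$ with $\sum r_i=k$, $\sum i r_i=n$. $\widetilde{B}_{n,k}$ denotes $B_{n,k}$ with $X_1$ replaced by $0$. Elements $S_{n,k}\in R$: $S_{0,0}=X_1^{ -1}$, $S_{n,0}=0$ ($n\geq1$), $S_{n,k}=0$ ($0\leq n<k$), and for $n\geq0$, $1\leq k\leq n+1$: $S_{n+1,k}=-(2n-1)X_2S_{n,k}+X_1\big(S_{n,k-1}+\sum_{j=1}^{n-k+1}X_{j+1}\,\partial S_{n,k}/\partial X_j\big)$. -}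

module Defs where

open import Data.Bool using (Bool; true; false; if_then_else_)
open import Data.Nat as ℕ using (ℕ; zero; suc; _∸_)
open import Data.Nat.Combinatorics using (_C_)
open import Data.Nat.Base using (_!)
import Data.Nat.DivMod as ℕD
open import Data.Integer as ℤ using (ℤ; +_; 0ℤ; 1ℤ)
open import Data.List using (List; []; _∷_; _++_; map; concatMap; foldr; upTo; filter; length; replicate)
import Data.List.Properties as LP
open import Data.Product using (_×_; _,_; proj₁; proj₂)
import Data.Product.Properties as PP
open import Relation.Binary.PropositionalEquality using (_≡_)
open import Relation.Nullary using (does)
open import Relation.Nullary.Decidable using (_×-dec_)

-- The ring R = ℤ[X₁, X₁⁻¹, X₂, X₃, …], represented by finite lists of
-- terms; equality is coefficientwise equality (_≈_ below).

-- A monomial X₁^e · X₂^{a₀} · X₃^{a₁} · … is (e , a₀ ∷ a₁ ∷ …),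
-- missing trailing exponents being 0.
Mono : Set
Mono = ℤ × List ℕ

Poly : Set
Poly = List (ℤ × Mono)

cons0 : ℕ → List ℕ → List ℕ
cons0 zero [] = []
cons0 x ys = x ∷ ys

strip : List ℕ → List ℕ
strip [] = []
strip (x ∷ xs) = cons0 x (strip xs)

normMono : Mono → Mono
normMono (e , as) = (e , strip as)

sameMono : Mono → Mono → Bool
sameMono m m' = does (PP.≡-dec ℤ._≟_ (LP.≡-dec ℕ._≟_) (normMono m) (normMono m'))

coeff : Poly → Mono → ℤ
coeff [] m = 0ℤ
coeff ((c , m') ∷ p) m = (if sameMono m' m then c else 0ℤ) ℤ.+ coeff p m

infix 4 _≈_
_≈_ : Poly → Poly → Set
p ≈ q = ∀ (m : Mono) → coeff p m ≡ coeff q m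

0P : Poly
0P = []

1P : Poly
1P = (1ℤ , (0ℤ , [])) ∷ []

infixl 6 _+P_
infixl 7 _*P_ _·_

_+P_ : Poly → Poly → Poly
p +P q = p ++ q

addExp : List ℕ → List ℕ → List ℕ
addExp [] ys = ys
addExp xs [] = xs
addExp (x ∷ xs) (y ∷ ys) = (x ℕ.+ y) ∷ addExp xs ys

mulMono : Mono → Mono → Mono
mulMono (e , as) (e' , bs) = (e ℤ.+ e' , addExp as bs)

_*P_ : Poly → Poly → Poly
p *P q = concatMap (λ { (c , m) → map (λ { (d , m') → (c ℤ.* d , mulMono m m') }) q }) p

_·_ : ℤ → Poly → Poly
a · p = map (λ { (c , m) → (a ℤ.* c , m) }) p

-- the variables: X 1 = X₁, X (suc (suc i)) = X_{i+2}; X 0 is unused (set to 0)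
X : ℕ → Poly
X zero = 0P
X (suc zero) = (1ℤ , (+ 1 , [])) ∷ []
X (suc (suc i)) = (1ℤ , (0ℤ , replicate i 0 ++ (1 ∷ []))) ∷ []

X₁⁻¹ : Poly
X₁⁻¹ = (1ℤ , (ℤ.-[1+ 0 ] , [])) ∷ []

-- partial derivative with respect to X_j (j ≥ 1); ∂ 0 is unused (set to 0)
nth : List ℕ → ℕ → ℕ
nth [] i = 0
nth (x ∷ xs) zero = x
nth (x ∷ xs) (suc i) = nth xs i

decAt : List ℕ → ℕ → List ℕ
decAt [] i = []
decAt (x ∷ xs) zero = (x ∸ 1) ∷ xs
decAt (x ∷ xs) (suc i) = x ∷ decAt xs i

∂ : ℕ → Poly → Poly
∂ zero p = 0P
∂ (suc zero) p = map (λ { (c , (e , as)) → (c ℤ.* e , (e ℤ.- 1ℤ , as)) }) p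
∂ (suc (suc i)) p = map (λ { (c , (e , as)) → (c ℤ.* (+ nth as i) , (e , decAt as i)) }) p

-- substitution X₁ := 0 (on terms with non-negative X₁-exponent; terms with
-- positive X₁-exponent vanish)
X₁:=0 : Poly → Poly
X₁:=0 = filter (λ t → ℤ._≟_ (proj₁ (proj₂ t)) 0ℤ)

sumP : List Poly → Poly
sumP = foldr _+P_ 0P

-- Σ[ j = a .. b ] f j   (empty if b < a)
range : ℕ → ℕ → List ℕ
range a b = map (a ℕ.+_) (upTo (suc b ∸ a))

Σ[_⋯_] : ℕ → ℕ → (ℕ → Poly) → Poly
Σ[ a ⋯ b ] f = sumP (map f (range a b))

binom : ℕ → ℕ → ℤ
binom n k = + (n C k)

S : ℕ → ℕ → Poly
S zero zero = X₁⁻¹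
S zero (suc k) = 0P
S (suc n) zero = 0P
S (suc n) (suc k) =
  if does (k ℕ.≤? n)
  then (((+ 1) ℤ.- (+ (2 ℕ.* n))) · (X 2 *P S n (suc k)))
       +P X 1 *P (S n k +P Σ[ 1 ⋯ n ∸ suc k ℕ.+ 1 ] (λ j → X (suc j) *P ∂ j (S n (suc k))))
  else 0P

tuples : ℕ → ℕ → List (List ℕ)
tuples zero b = [] ∷ []
tuples (suc m) b = concatMap (λ x → map (x ∷_) (tuples m b)) (upTo (suc b))

sumN : List ℕ → ℕ
sumN = foldr ℕ._+_ 0

wsum : ℕ → List ℕ → ℕ
wsum i [] = 0
wsum i (r ∷ rs) = i ℕ.* r ℕ.+ wsum (suc i) rs

denom : ℕ → List ℕ → ℕ
denom i [] = 1
denom i (r ∷ rs) = (r !) ℕ.* ((i !) ℕ.^ r) ℕ.* denom (suc i) rs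

-- natural-number division (the denominator is never 0 here)
divN : ℕ → ℕ → ℕ
divN a zero = 0
divN a (suc d) = ℕD._/_ a (suc d)

bellTerm : ℕ → List ℕ → ℤ × Mono
bellTerm n [] = (+ divN (n !) 1 , (0ℤ , []))
bellTerm n (r₁ ∷ rs) = (+ divN (n !) (denom 1 (r₁ ∷ rs)) , (+ r₁ , rs))

B : ℕ → ℕ → Poly
B zero zero = 1P
B (suc n) zero = 0P
B n (suc k) =
  if does (suc k ℕ.≤? n)
  then map (bellTerm n)
           (filter (λ r → (sumN r ℕ.≟ suc k) ×-dec (wsum 1 r ℕ.≟ n))
                   (tuples (n ∸ suc k ℕ.+ 1) (suc k)))
  else 0P

B̃ : ℕ → ℕ → Poly
B̃ n k = X₁:=0 (B n k)

module Submission where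

-- Everything is
-- reduced to the pairing ⟨p, g⟩ = Σ c·g(m) of a polynomial with a weight on
-- monomials: coefficients are pairings, products are iterated pairings and
-- equal polynomials pair equally with invariant weights.  This makes R a
-- commutative ring (so the ring solver applies), each ∂_j a derivation, and
-- D_N = Σ_{j ≤ N} X_{j+1} ∂_j a derivation with D_N X₁ = X₂ that does not
-- depend on N beyond the variables involved.  (i) is proved for the
-- convolution extended to all j by induction on n: the recursion for
-- S_{n+1,k}, Leibniz' rule, the recursion applied to the factors and
-- Pascal's rule.  (ii) is proved coefficientwise: the coefficients of B̃_{n,k}
-- are multinomial numbers, multiplication by X_{i+2} shifts exponents, and
-- the multinomial numbers satisfy the recursion removing one part i+2.

open import Defs
open import Algebra.Bundles using (CommutativeRing)
open import Algebra.Structures using (IsCommutativeRing)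
import Algebra.Solver.Ring.AlmostCommutativeRing as ACR
open import Data.Bool using (true; false; if_then_else_)
open import Data.Empty using (⊥-elim)
open import Data.List using (List; []; _∷_; _++_; map; concatMap; filter; length; replicate; upTo; applyUpTo)
import Data.List.Properties as LP
open import Data.List.Relation.Unary.All as All using (All; []; _∷_)
import Data.List.Relation.Unary.All.Properties as AllP
open import Data.Maybe using (Maybe; just; nothing)
open import Data.Nat as ℕ using (ℕ; zero; suc; _+_; _*_; _∸_; _^_; _!; _≤_; _<_; z≤n; s≤s; _⊔_)
import Data.Nat.Properties as ℕP
open import Data.Nat.Combinatorics using (_C_; nCn≡1; k>n⇒nCk≡0; nCk+nC[k+1]≡[n+1]C[k+1]; nCk≡n!/k![n-k]!; k![n∸k]!∣n!)
open import Data.Nat.DivMod using (m/n*n≡m; m*n/n≡m)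
open import Data.Nat.Tactic.RingSolver using () renaming (solve-∀ to solveℕ-∀)
open import Data.Integer as ℤ using (ℤ; +_; 0ℤ; 1ℤ; -1ℤ) renaming (_+_ to _+ℤ_; _*_ to _*ℤ_; _-_ to _-ℤ_)
import Data.Integer.Properties as ℤP
open import Data.Integer.Tactic.RingSolver using (solve-∀)
open import Data.Product using (_×_; _,_; proj₁; proj₂)
import Data.Product.Properties as PP
open import Relation.Binary.PropositionalEquality as ≡ using (_≡_; _≢_; refl; sym; trans; cong; cong₂; subst)
open import Relation.Binary.Structures using (IsEquivalence)
import Relation.Binary.Reasoning.Setoid
open import Relation.Nullary using (Dec; does; yes; no; ¬_)
open import Relation.Nullary.Decidable using (dec-true; dec-false; _×-dec_)
open import Relation.Unary using (Pred; Decidable)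

sumL : {A : Set} → List A → (A → ℤ) → ℤ
sumL [] f = 0ℤ
sumL (x ∷ xs) f = f x +ℤ sumL xs f

sumL-++ : {A : Set} (xs ys : List A) (f : A → ℤ) → sumL (xs ++ ys) f ≡ sumL xs f +ℤ sumL ys f
sumL-++ [] ys f = sym (ℤP.+-identityˡ _)
sumL-++ (x ∷ xs) ys f = trans (cong (f x +ℤ_) (sumL-++ xs ys f)) (sym (ℤP.+-assoc (f x) _ _))

sumL-map : {A B : Set} (h : A → B) (xs : List A) (f : B → ℤ) → sumL (map h xs) f ≡ sumL xs (λ x → f (h x))
sumL-map h [] f = refl
sumL-map h (x ∷ xs) f = cong (f (h x) +ℤ_) (sumL-map h xs f)

sumL-concatMap : {A B : Set} (h : A → List B) (xs : List A) (f : B → ℤ) →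
  sumL (concatMap h xs) f ≡ sumL xs (λ x → sumL (h x) f)
sumL-concatMap h [] f = refl
sumL-concatMap h (x ∷ xs) f =
  trans (sumL-++ (h x) (concatMap h xs) f) (cong (sumL (h x) f +ℤ_) (sumL-concatMap h xs f))

sumL-cong : {A : Set} (xs : List A) {f g : A → ℤ} → (∀ x → f x ≡ g x) → sumL xs f ≡ sumL xs g
sumL-cong [] eq = refl
sumL-cong (x ∷ xs) eq = cong₂ _+ℤ_ (eq x) (sumL-cong xs eq)

sumL-+ : {A : Set} (xs : List A) (f g : A → ℤ) → sumL xs (λ x → f x +ℤ g x) ≡ sumL xs f +ℤ sumL xs g
sumL-+ [] f g = refl
sumL-+ (x ∷ xs) f g = trans (cong (f x +ℤ g x +ℤ_) (sumL-+ xs f g)) (interchange (f x) (g x) _ _)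
  where interchange : ∀ a b c d → (a +ℤ b) +ℤ (c +ℤ d) ≡ (a +ℤ c) +ℤ (b +ℤ d)
        interchange = solve-∀

sumL-* : {A : Set} (xs : List A) (a : ℤ) (f : A → ℤ) → sumL xs (λ x → a *ℤ f x) ≡ a *ℤ sumL xs f
sumL-* [] a f = sym (ℤP.*-zeroʳ a)
sumL-* (x ∷ xs) a f = trans (cong (a *ℤ f x +ℤ_) (sumL-* xs a f)) (sym (ℤP.*-distribˡ-+ a (f x) _))

sumL-0 : {A : Set} (xs : List A) → sumL xs (λ _ → 0ℤ) ≡ 0ℤ
sumL-0 [] = refl
sumL-0 (x ∷ xs) = trans (ℤP.+-identityˡ _) (sumL-0 xs)

sumL-swap : {A B : Set} (xs : List A) (ys : List B) (f : A → B → ℤ) →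
  sumL xs (λ x → sumL ys (f x)) ≡ sumL ys (λ y → sumL xs (λ x → f x y))
sumL-swap [] ys f = sym (sumL-0 ys)
sumL-swap (x ∷ xs) ys f =
  trans (cong (sumL ys (f x) +ℤ_) (sumL-swap xs ys f)) (sym (sumL-+ ys (f x) (λ y → sumL xs (λ x → f x y))))

_~_ : Mono → Mono → Set
m ~ m' = normMono m ≡ normMono m'

_~?_ : (m m' : Mono) → Dec (m ~ m')
m ~? m' = PP.≡-dec ℤ._≟_ (LP.≡-dec ℕ._≟_) (normMono m) (normMono m')

sameMono-true : ∀ m m' → m ~ m' → sameMono m m' ≡ true
sameMono-true m m' = dec-true (m ~? m')

sameMono-false : ∀ m m' → ¬ m ~ m' → sameMono m m' ≡ false
sameMono-false m m' = dec-false (m ~? m')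

Invariant : (Mono → ℤ) → Set
Invariant g = ∀ m m' → m ~ m' → g m ≡ g m'

pairing : Poly → (Mono → ℤ) → ℤ
pairing p g = sumL p (λ t → proj₁ t *ℤ g (proj₂ t))

δ : Mono → Mono → ℤ
δ m m' = if sameMono m' m then 1ℤ else 0ℤ

δ-invariant : ∀ m → Invariant (δ m)
δ-invariant m m₁ m₂ eq =
  cong (λ x → if does (PP.≡-dec ℤ._≟_ (LP.≡-dec ℕ._≟_) x (normMono m)) then 1ℤ else 0ℤ) eq

coeff-pairing : ∀ p m → coeff p m ≡ pairing p (δ m)
coeff-pairing [] m = refl
coeff-pairing ((c , m') ∷ p) m = cong₂ _+ℤ_ (select (sameMono m' m)) (coeff-pairing p m)
  where select : ∀ b → (if b then c else 0ℤ) ≡ c *ℤ (if b then 1ℤ else 0ℤ)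
        select true = sym (ℤP.*-identityʳ c)
        select false = sym (ℤP.*-zeroʳ c)

pairing-++ : ∀ p q g → pairing (p ++ q) g ≡ pairing p g +ℤ pairing q g
pairing-++ p q g = sumL-++ p q _

pairing-+ : ∀ p f g → pairing p (λ x → f x +ℤ g x) ≡ pairing p f +ℤ pairing p g
pairing-+ p f g = trans (sumL-cong p (λ t → ℤP.*-distribˡ-+ (proj₁ t) _ _)) (sumL-+ p _ _)

pairing-* : ∀ p a f → pairing p (λ x → a *ℤ f x) ≡ a *ℤ pairing p f
pairing-* p a f = trans (sumL-cong p (λ t → swap (proj₁ t) a (f (proj₂ t)))) (sumL-* p a _)
  where swap : ∀ x y z → x *ℤ (y *ℤ z) ≡ y *ℤ (x *ℤ z)
        swap = solve-∀

pairing-cong : ∀ p {f g} → (∀ x → f x ≡ g x) → pairing p f ≡ pairing p g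
pairing-cong p eq = sumL-cong p (λ t → cong (proj₁ t *ℤ_) (eq (proj₂ t)))

pairing-0 : ∀ p → pairing p (λ _ → 0ℤ) ≡ 0ℤ
pairing-0 p = trans (sumL-cong p (λ t → ℤP.*-zeroʳ (proj₁ t))) (sumL-0 p)

pairing-· : ∀ a p g → pairing (a · p) g ≡ a *ℤ pairing p g
pairing-· a [] g = sym (ℤP.*-zeroʳ a)
pairing-· a ((c , m) ∷ p) g =
  trans (cong₂ _+ℤ_ (ℤP.*-assoc a c (g m)) (pairing-· a p g)) (sym (ℤP.*-distribˡ-+ a _ _))

coeff-++ : ∀ p q m → coeff (p ++ q) m ≡ coeff p m +ℤ coeff q m
coeff-++ p q m = trans (coeff-pairing (p ++ q) m)
  (trans (pairing-++ p q (δ m)) (sym (cong₂ _+ℤ_ (coeff-pairing p m) (coeff-pairing q m))))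

coeff-· : ∀ a p m → coeff (a · p) m ≡ a *ℤ coeff p m
coeff-· a p m = trans (coeff-pairing (a · p) m) (trans (pairing-· a p (δ m)) (cong (a *ℤ_) (sym (coeff-pairing p m))))

-- The
-- proof separates the terms of a polynomial with a given monomial from the
-- others and proceeds by induction on the number of terms.

select reject : Mono → Poly → Poly
select m [] = []
select m ((c , m') ∷ r) = if sameMono m' m then (c , m') ∷ select m r else select m r
reject m [] = []
reject m ((c , m') ∷ r) = if sameMono m' m then reject m r else (c , m') ∷ reject m r

pairing-split : ∀ m r g → pairing r g ≡ pairing (select m r) g +ℤ pairing (reject m r) g
pairing-split m [] g = refl
pairing-split m ((c , m') ∷ r) g with m' ~? m
... | yes _ = trans (cong (c *ℤ g m' +ℤ_) (pairing-split m r g)) (sym (ℤP.+-assoc (c *ℤ g m') _ _))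
... | no _ = trans (cong (c *ℤ g m' +ℤ_) (pairing-split m r g)) (exchange (c *ℤ g m') (pairing (select m r) g) (pairing (reject m r) g))
  where exchange : ∀ a b d → a +ℤ (b +ℤ d) ≡ b +ℤ (a +ℤ d)
        exchange = solve-∀

pairing-select : ∀ m r g → Invariant g → pairing (select m r) g ≡ coeff r m *ℤ g m
pairing-select m [] g inv = refl
pairing-select m ((c , m') ∷ r) g inv with m' ~? m
... | yes h = trans (cong₂ (λ x y → c *ℤ x +ℤ y) (inv m' m h) (pairing-select m r g inv))
                    (sym (ℤP.*-distribʳ-+ (g m) c (coeff r m)))
... | no _ = trans (pairing-select m r g inv) (cong (_*ℤ g m) (sym (ℤP.+-identityˡ (coeff r m))))

coeff-split : ∀ m r m₂ → coeff r m₂ ≡ coeff (select m r) m₂ +ℤ coeff (reject m r) m₂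
coeff-split m r m₂ = trans (coeff-pairing r m₂) (trans (pairing-split m r (δ m₂))
  (sym (cong₂ _+ℤ_ (coeff-pairing (select m r) m₂) (coeff-pairing (reject m r) m₂))))

coeff-reject-same : ∀ m r m₂ → m₂ ~ m → coeff (reject m r) m₂ ≡ 0ℤ
coeff-reject-same m [] m₂ e = refl
coeff-reject-same m ((c , m') ∷ r) m₂ e with m' ~? m
... | yes _ = coeff-reject-same m r m₂ e
... | no h rewrite sameMono-false m' m₂ (λ h' → h (trans h' e)) =
  trans (ℤP.+-identityˡ _) (coeff-reject-same m r m₂ e)

coeff-select-other : ∀ m r m₂ → ¬ m₂ ~ m → coeff (select m r) m₂ ≡ 0ℤ
coeff-select-other m [] m₂ e = refl
coeff-select-other m ((c , m') ∷ r) m₂ e with m' ~? m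
... | yes h rewrite sameMono-false m' m₂ (λ h' → e (trans (sym h') h)) =
  trans (ℤP.+-identityˡ _) (coeff-select-other m r m₂ e)
... | no _ = coeff-select-other m r m₂ e

length-reject : ∀ m r → length (reject m r) ≤ length r
length-reject m [] = z≤n
length-reject m ((c , m') ∷ r) with m' ~? m
... | yes _ = ℕP.m≤n⇒m≤1+n (length-reject m r)
... | no _ = s≤s (length-reject m r)

module _ (c : ℤ) (m : Mono) (r : Poly) (null : ∀ m₂ → coeff ((c , m) ∷ r) m₂ ≡ 0ℤ) where

  head-cancels : c +ℤ coeff r m ≡ 0ℤ
  head-cancels = trans (cong (λ b → (if b then c else 0ℤ) +ℤ coeff r m) (sym (sameMono-true m m refl))) (null m)

  reject-null : ∀ m₂ → coeff (reject m r) m₂ ≡ 0ℤ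
  reject-null m₂ with m₂ ~? m
  ... | yes h = coeff-reject-same m r m₂ h
  ... | no h = begin
      coeff (reject m r) m₂                            ≡⟨ sym (ℤP.+-identityˡ _) ⟩
      0ℤ +ℤ coeff (reject m r) m₂                      ≡⟨ cong (_+ℤ coeff (reject m r) m₂) (sym (coeff-select-other m r m₂ h)) ⟩
      coeff (select m r) m₂ +ℤ coeff (reject m r) m₂  ≡⟨ sym (coeff-split m r m₂) ⟩
      coeff r m₂                                       ≡⟨ sym (ℤP.+-identityˡ _) ⟩
      0ℤ +ℤ coeff r m₂                                 ≡⟨ cong (λ b → (if b then c else 0ℤ) +ℤ coeff r m₂) (sym (sameMono-false m m₂ (λ h' → h (sym h')))) ⟩
      coeff ((c , m) ∷ r) m₂                           ≡⟨ null m₂ ⟩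
      0ℤ                                               ∎
    where open ≡.≡-Reasoning

pairing-null : ∀ n r → length r ≤ n → (∀ m → coeff r m ≡ 0ℤ) → ∀ g → Invariant g → pairing r g ≡ 0ℤ
pairing-null n [] _ _ g _ = refl
pairing-null (suc n) ((c , m) ∷ r) (s≤s len) null g inv = begin
    c *ℤ g m +ℤ pairing r g
  ≡⟨ cong (c *ℤ g m +ℤ_) (pairing-split m r g) ⟩
    c *ℤ g m +ℤ (pairing (select m r) g +ℤ pairing (reject m r) g)
  ≡⟨ cong₂ (λ a b → c *ℤ g m +ℤ (a +ℤ b)) (pairing-select m r g inv)
       (pairing-null n (reject m r) (ℕP.≤-trans (length-reject m r) len) (reject-null c m r null) g inv) ⟩
    c *ℤ g m +ℤ (coeff r m *ℤ g m +ℤ 0ℤ)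
  ≡⟨ collect c (coeff r m) (g m) ⟩
    (c +ℤ coeff r m) *ℤ g m
  ≡⟨ cong (_*ℤ g m) (head-cancels c m r null) ⟩
    0ℤ
  ∎
  where
    open ≡.≡-Reasoning
    collect : ∀ a b d → a *ℤ d +ℤ (b *ℤ d +ℤ 0ℤ) ≡ (a +ℤ b) *ℤ d
    collect = solve-∀

pairing-≈ : ∀ p q → p ≈ q → ∀ g → Invariant g → pairing p g ≡ pairing q g
pairing-≈ p q eq g inv = cancel (pairing p g) (pairing q g) difference-null
  where
    difference : Poly
    difference = p ++ (-1ℤ · q)
    coeff-difference : ∀ m → coeff difference m ≡ 0ℤ
    coeff-difference m = trans (coeff-++ p _ m) (trans (cong₂ _+ℤ_ (eq m) (coeff-· -1ℤ q m)) (a-a (coeff q m)))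
      where a-a : ∀ a → a +ℤ -1ℤ *ℤ a ≡ 0ℤ
            a-a = solve-∀
    difference-null : pairing p g +ℤ -1ℤ *ℤ pairing q g ≡ 0ℤ
    difference-null = trans (sym (trans (pairing-++ p _ g) (cong (pairing p g +ℤ_) (pairing-· -1ℤ q g))))
                            (pairing-null (length difference) difference ℕP.≤-refl coeff-difference g inv)
    cancel : ∀ a b → a +ℤ -1ℤ *ℤ b ≡ 0ℤ → a ≡ b
    cancel a b h = trans (shift a b) (trans (cong (_+ℤ b) h) (ℤP.+-identityˡ b))
      where shift : ∀ a b → a ≡ (a +ℤ -1ℤ *ℤ b) +ℤ b
            shift = solve-∀

nth-cons0 : ∀ x l i → nth (cons0 x l) i ≡ nth (x ∷ l) i
nth-cons0 zero [] zero = refl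
nth-cons0 zero [] (suc i) = refl
nth-cons0 zero (y ∷ l) i = refl
nth-cons0 (suc x) l i = refl

nth-strip : ∀ xs i → nth (strip xs) i ≡ nth xs i
nth-strip [] i = refl
nth-strip (x ∷ xs) i = trans (nth-cons0 x (strip xs) i) (tail i)
  where tail : ∀ i → nth (x ∷ strip xs) i ≡ nth (x ∷ xs) i
        tail zero = refl
        tail (suc i) = nth-strip xs i

strip-ext : ∀ xs ys → (∀ i → nth xs i ≡ nth ys i) → strip xs ≡ strip ys
strip-ext [] [] h = refl
strip-ext [] (y ∷ ys) h rewrite sym (h zero) | sym (strip-ext [] ys (λ i → h (suc i))) = refl
strip-ext (x ∷ xs) [] h rewrite h zero | strip-ext xs [] (λ i → h (suc i)) = refl
strip-ext (x ∷ xs) (y ∷ ys) h rewrite h zero | strip-ext xs ys (λ i → h (suc i)) = refl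

strip-nth : ∀ xs ys → strip xs ≡ strip ys → ∀ i → nth xs i ≡ nth ys i
strip-nth xs ys eq i = trans (sym (nth-strip xs i)) (trans (cong (λ l → nth l i) eq) (nth-strip ys i))

~-intro : ∀ e e' as bs → e ≡ e' → (∀ i → nth as i ≡ nth bs i) → (e , as) ~ (e' , bs)
~-intro e e' as bs eq h = cong₂ _,_ eq (strip-ext as bs h)

~-exp : ∀ {e e' as bs} → (e , as) ~ (e' , bs) → e ≡ e'
~-exp eq = cong proj₁ eq

~-nth : ∀ {e e' as bs} → (e , as) ~ (e' , bs) → ∀ i → nth as i ≡ nth bs i
~-nth {as = as} {bs = bs} eq = strip-nth as bs (cong proj₂ eq)

nth-addExp : ∀ as bs i → nth (addExp as bs) i ≡ nth as i + nth bs i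
nth-addExp [] bs i = refl
nth-addExp (x ∷ as) [] i = sym (ℕP.+-identityʳ _)
nth-addExp (x ∷ as) (y ∷ bs) zero = refl
nth-addExp (x ∷ as) (y ∷ bs) (suc i) = nth-addExp as bs i

mulMono-congˡ : ∀ m₁ m₁' m₂ → m₁ ~ m₁' → mulMono m₁ m₂ ~ mulMono m₁' m₂
mulMono-congˡ (e , as) (e' , as') (f , bs) eq =
  ~-intro _ _ (addExp as bs) (addExp as' bs) (cong (_+ℤ f) (~-exp {e} {e'} {as} {as'} eq)) entries
  where
    entries : ∀ i → nth (addExp as bs) i ≡ nth (addExp as' bs) i
    entries i = trans (nth-addExp as bs i)
      (trans (cong (_+ nth bs i) (~-nth {e} {e'} {as} {as'} eq i)) (sym (nth-addExp as' bs i)))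

mulMono-comm : ∀ m₁ m₂ → mulMono m₁ m₂ ~ mulMono m₂ m₁
mulMono-comm (e , as) (f , bs) = ~-intro _ _ (addExp as bs) (addExp bs as) (ℤP.+-comm e f)
  (λ i → trans (nth-addExp as bs i) (trans (ℕP.+-comm (nth as i) _) (sym (nth-addExp bs as i))))

mulMono-assoc : ∀ m₁ m₂ m₃ → mulMono (mulMono m₁ m₂) m₃ ~ mulMono m₁ (mulMono m₂ m₃)
mulMono-assoc (e , as) (f , bs) (g , cs) =
  ~-intro _ _ (addExp (addExp as bs) cs) (addExp as (addExp bs cs)) (ℤP.+-assoc e f g) entries
  where
    open ≡.≡-Reasoning
    entries : ∀ i → nth (addExp (addExp as bs) cs) i ≡ nth (addExp as (addExp bs cs)) i
    entries i = begin
      nth (addExp (addExp as bs) cs) i       ≡⟨ nth-addExp (addExp as bs) cs i ⟩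
      nth (addExp as bs) i + nth cs i        ≡⟨ cong (_+ nth cs i) (nth-addExp as bs i) ⟩
      nth as i + nth bs i + nth cs i         ≡⟨ ℕP.+-assoc (nth as i) _ _ ⟩
      nth as i + (nth bs i + nth cs i)       ≡⟨ cong (λ z → nth as i + z) (sym (nth-addExp bs cs i)) ⟩
      nth as i + nth (addExp bs cs) i        ≡⟨ sym (nth-addExp as (addExp bs cs) i) ⟩
      nth (addExp as (addExp bs cs)) i       ∎

mulMono-congʳ : ∀ m₁ m₂ m₂' → m₂ ~ m₂' → mulMono m₁ m₂ ~ mulMono m₁ m₂'
mulMono-congʳ m₁ m₂ m₂' eq =
  trans (mulMono-comm m₁ m₂) (trans (mulMono-congˡ m₂ m₂' m₁ eq) (mulMono-comm m₂' m₁))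

pairing-*P-term : ∀ c m q g → pairing (((c , m) ∷ []) *P q) g ≡ c *ℤ pairing q (λ m₂ → g (mulMono m m₂))
pairing-*P-term c m [] g = sym (ℤP.*-zeroʳ c)
pairing-*P-term c m ((d , m') ∷ q) g =
  trans (cong₂ _+ℤ_ (ℤP.*-assoc c d _) (pairing-*P-term c m q g)) (sym (ℤP.*-distribˡ-+ c _ _))

*P-cons : ∀ c m p q → ((c , m) ∷ p) *P q ≡ (((c , m) ∷ []) *P q) ++ (p *P q)
*P-cons c m p q = cong (_++ (p *P q)) (sym (LP.++-identityʳ (map (λ t → (c *ℤ proj₁ t , mulMono m (proj₂ t))) q)))

pairing-*P : ∀ p q g → pairing (p *P q) g ≡ pairing p (λ m₁ → pairing q (λ m₂ → g (mulMono m₁ m₂)))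
pairing-*P [] q g = refl
pairing-*P ((c , m) ∷ p) q g =
  trans (cong (λ z → pairing z g) (*P-cons c m p q))
  (trans (pairing-++ (((c , m) ∷ []) *P q) (p *P q) g) (cong₂ _+ℤ_ (pairing-*P-term c m q g) (pairing-*P p q g)))

coeff-*P : ∀ p q m → coeff (p *P q) m ≡ pairing p (λ m₁ → pairing q (λ m₂ → δ m (mulMono m₁ m₂)))
coeff-*P p q m = trans (coeff-pairing (p *P q) m) (pairing-*P p q (δ m))

pairing-swap : (p q : Poly) (h : Mono → Mono → ℤ) →
  pairing p (λ x → pairing q (h x)) ≡ pairing q (λ y → pairing p (λ x → h x y))
pairing-swap p q h =
  trans (sumL-cong p (λ t → sym (pairing-* q (proj₁ t) (h (proj₂ t)))))
  (trans (sumL-swap p q (λ t s → proj₁ s *ℤ (proj₁ t *ℤ h (proj₂ t) (proj₂ s))))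
         (sumL-cong q (λ s → sumL-* p (proj₁ s) (λ t → proj₁ t *ℤ h (proj₂ t) (proj₂ s)))))

≈-refl : ∀ {p} → p ≈ p
≈-refl m = refl

≈-sym : ∀ {p q} → p ≈ q → q ≈ p
≈-sym e m = sym (e m)

≈-trans : ∀ {p q r} → p ≈ q → q ≈ r → p ≈ r
≈-trans e f m = trans (e m) (f m)

-P_ : Poly → Poly
-P p = -1ℤ · p

+P-cong : ∀ {p p' q q'} → p ≈ p' → q ≈ q' → p +P q ≈ p' +P q'
+P-cong {p} {p'} {q} {q'} e f m = trans (coeff-++ p q m) (trans (cong₂ _+ℤ_ (e m) (f m)) (sym (coeff-++ p' q' m)))

+P-comm : ∀ p q → p +P q ≈ q +P p
+P-comm p q m = trans (coeff-++ p q m) (trans (ℤP.+-comm (coeff p m) (coeff q m)) (sym (coeff-++ q p m)))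

+P-assoc : ∀ p q r → (p +P q) +P r ≈ p +P (q +P r)
+P-assoc p q r m = cong (λ s → coeff s m) (LP.++-assoc p q r)

+P-identityʳ : ∀ p → p +P 0P ≈ p
+P-identityʳ p m = cong (λ s → coeff s m) (LP.++-identityʳ p)

-P-inverseˡ : ∀ p → (-P p) +P p ≈ 0P
-P-inverseˡ p m = trans (coeff-++ (-P p) p m) (trans (cong (_+ℤ coeff p m) (coeff-· -1ℤ p m)) (-a+a (coeff p m)))
  where -a+a : ∀ a → -1ℤ *ℤ a +ℤ a ≡ 0ℤ
        -a+a = solve-∀

·-cong : ∀ a {p q} → p ≈ q → a · p ≈ a · q
·-cong a {p} {q} e m = trans (coeff-· a p m) (trans (cong (a *ℤ_) (e m)) (sym (coeff-· a q m)))

-- Multiplication respects ≈: the weights involved are invariant.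
*P-congˡ : ∀ {p p'} q → p ≈ p' → p *P q ≈ p' *P q
*P-congˡ {p} {p'} q e m = trans (coeff-*P p q m) (trans (pairing-≈ p p' e _ invariant) (sym (coeff-*P p' q m)))
  where invariant : Invariant (λ m₁ → pairing q (λ m₂ → δ m (mulMono m₁ m₂)))
        invariant m₁ m₁' h = pairing-cong q (λ m₂ → δ-invariant m (mulMono m₁ m₂) (mulMono m₁' m₂) (mulMono-congˡ m₁ m₁' m₂ h))

*P-congʳ : ∀ p {q q'} → q ≈ q' → p *P q ≈ p *P q'
*P-congʳ p {q} {q'} e m = trans (coeff-*P p q m) (trans (pairing-cong p inner) (sym (coeff-*P p q' m)))
  where inner : ∀ m₁ → pairing q (λ m₂ → δ m (mulMono m₁ m₂)) ≡ pairing q' (λ m₂ → δ m (mulMono m₁ m₂))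
        inner m₁ = pairing-≈ q q' e _ (λ m₂ m₂' h → δ-invariant m (mulMono m₁ m₂) (mulMono m₁ m₂') (mulMono-congʳ m₁ m₂ m₂' h))

*P-comm : ∀ p q → p *P q ≈ q *P p
*P-comm p q m = trans (coeff-*P p q m) (trans (pairing-swap p q (λ m₁ m₂ → δ m (mulMono m₁ m₂)))
  (trans (pairing-cong q (λ m₂ → pairing-cong p (λ m₁ → δ-invariant m (mulMono m₁ m₂) (mulMono m₂ m₁) (mulMono-comm m₁ m₂)))) (sym (coeff-*P q p m))))

*P-assoc : ∀ p q r → (p *P q) *P r ≈ p *P (q *P r)
*P-assoc p q r m =
  trans (coeff-*P (p *P q) r m)
  (trans (pairing-*P p q _)
  (trans (pairing-cong p (λ m₁ → pairing-cong q (λ m₂ → pairing-cong r (λ m₃ →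
            δ-invariant m (mulMono (mulMono m₁ m₂) m₃) (mulMono m₁ (mulMono m₂ m₃)) (mulMono-assoc m₁ m₂ m₃)))))
  (trans (pairing-cong p (λ m₁ → sym (pairing-*P q r _)))
  (sym (coeff-*P p (q *P r) m)))))

*P-distribʳ : ∀ r p q → (p +P q) *P r ≈ (p *P r) +P (q *P r)
*P-distribʳ r p q m = trans (coeff-*P (p +P q) r m) (trans (pairing-++ p q _)
  (trans (cong₂ _+ℤ_ (sym (coeff-*P p r m)) (sym (coeff-*P q r m))) (sym (coeff-++ (p *P r) (q *P r) m))))

*P-distribˡ : ∀ r p q → r *P (p +P q) ≈ (r *P p) +P (r *P q)
*P-distribˡ r p q m = trans (*P-comm r (p +P q) m) (trans (*P-distribʳ r p q m)
  (+P-cong {p *P r} {r *P p} {q *P r} {r *P q} (*P-comm p r) (*P-comm q r) m))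

*P-identityˡ : ∀ p → 1P *P p ≈ p
*P-identityˡ p m = trans (coeff-*P 1P p m) (trans unit (sym (coeff-pairing p m)))
  where unit : 1ℤ *ℤ pairing p (λ m₂ → δ m (mulMono (0ℤ , []) m₂)) +ℤ 0ℤ ≡ pairing p (δ m)
        unit = trans (ℤP.+-identityʳ _) (trans (ℤP.*-identityˡ _)
                 (pairing-cong p (λ { (e , as) → cong (λ z → δ m (z , as)) (ℤP.+-identityˡ e) })))

*P-identityʳ : ∀ p → p *P 1P ≈ p
*P-identityʳ p m = trans (*P-comm p 1P m) (*P-identityˡ p m)

-P-inverseʳ : ∀ p → p +P (-P p) ≈ 0P
-P-inverseʳ p m = trans (+P-comm p (-P p) m) (-P-inverseˡ p m)

*P-cong : ∀ {p p' q q'} → p ≈ p' → q ≈ q' → p *P q ≈ p' *P q'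
*P-cong {p} {p'} {q} {q'} e f m = trans (*P-congˡ {p} {p'} q e m) (*P-congʳ p' {q} {q'} f m)

-- Equality in R wrapped in a record, and the ring operations made opaque:
-- this keeps the ring solver from unfolding polynomials into lists.
record _≋_ (p q : Poly) : Set where
  constructor mk
  field un : p ≈ q
open _≋_ public

infix 4 _≋_
infixl 6 _⊕_
infixl 7 _⊛_

≋-isEquivalence : IsEquivalence _≋_
≋-isEquivalence = record
  { refl = λ {p} → mk (≈-refl {p})
  ; sym = λ {p} {q} e → mk (≈-sym {p} {q} (un e))
  ; trans = λ {p} {q} {r} e f → mk (≈-trans {p} {q} {r} (un e) (un f)) }

opaque
  _⊕_ _⊛_ : Poly → Poly → Poly
  _⊕_ = _+P_
  _⊛_ = _*P_

  ⊝_ : Poly → Poly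
  ⊝_ = -P_

  ⊕-def : ∀ p q → p ⊕ q ≡ p +P q
  ⊕-def p q = refl

  ⊛-def : ∀ p q → p ⊛ q ≡ p *P q
  ⊛-def p q = refl

  ⊝-def : ∀ p → ⊝ p ≡ -P p
  ⊝-def p = refl

  R-isCommutativeRing : IsCommutativeRing _≋_ _⊕_ _⊛_ ⊝_ 0P 1P
  R-isCommutativeRing = record
    { isRing = record
      { +-isAbelianGroup = record
        { isGroup = record
          { isMonoid = record
            { isSemigroup = record
              { isMagma = record { isEquivalence = ≋-isEquivalence ; ∙-cong = λ {p} {p'} {q} {q'} e f → mk (+P-cong {p} {p'} {q} {q'} (un e) (un f)) }
              ; assoc = λ p q r → mk (+P-assoc p q r) }
            ; identity = (λ p → mk (≈-refl {p})) , (λ p → mk (+P-identityʳ p)) }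
          ; inverse = (λ p → mk (-P-inverseˡ p)) , (λ p → mk (-P-inverseʳ p))
          ; ⁻¹-cong = λ {p} {q} e → mk (·-cong -1ℤ {p} {q} (un e)) }
        ; comm = λ p q → mk (+P-comm p q) }
      ; *-cong = λ {p} {p'} {q} {q'} e f → mk (*P-cong {p} {p'} {q} {q'} (un e) (un f))
      ; *-assoc = λ p q r → mk (*P-assoc p q r)
      ; *-identity = (λ p → mk (*P-identityˡ p)) , (λ p → mk (*P-identityʳ p))
      ; distrib = (λ r p q → mk (*P-distribˡ r p q)) , (λ r p q → mk (*P-distribʳ r p q)) }
    ; *-comm = λ p q → mk (*P-comm p q) }

R : CommutativeRing _ _
R = record { isCommutativeRing = R-isCommutativeRing }

open CommutativeRing R using (+-cong; *-cong; +-assoc; +-identityˡ; +-identityʳ; zeroˡ; zeroʳ;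
  distribˡ; distribʳ; *-comm; *-identityʳ; setoid)
  renaming (refl to ≋-refl; sym to ≋-sym; trans to ≋-trans)

module ≋-Reasoning = Relation.Binary.Reasoning.Setoid setoid

≡⇒≋ : ∀ {p q} → p ≡ q → p ≋ q
≡⇒≋ refl = ≋-refl

-- Constants: the ring homomorphism ℤ → R, which makes the ring solver
-- available for identities in R with integer coefficients.

K : ℤ → Poly
K a = (a , (0ℤ , [])) ∷ []

·≋K⊛ : ∀ a p → a · p ≋ K a ⊛ p
·≋K⊛ a p = mk pointwise
  where
    unit : ∀ m → a *ℤ coeff p m ≡ a *ℤ pairing p (λ m₂ → δ m (mulMono (0ℤ , []) m₂)) +ℤ 0ℤ
    unit m = trans (cong (a *ℤ_) (trans (coeff-pairing p m)
               (pairing-cong p (λ { (e , as) → cong (λ z → δ m (z , as)) (sym (ℤP.+-identityˡ e)) }))))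
             (sym (ℤP.+-identityʳ _))
    pointwise : ∀ m → coeff (a · p) m ≡ coeff (K a ⊛ p) m
    pointwise m = trans (coeff-· a p m) (trans (unit m)
      (sym (trans (cong (λ z → coeff z m) (⊛-def (K a) p)) (coeff-*P (K a) p m))))

K-+ : ∀ a b → K (a +ℤ b) ≋ K a ⊕ K b
K-+ a b = mk (λ m → trans (split (sameMono (0ℤ , []) m))
                   (sym (trans (cong (λ z → coeff z m) (⊕-def (K a) (K b))) (coeff-++ (K a) (K b) m))))
  where split : ∀ s → (if s then a +ℤ b else 0ℤ) +ℤ 0ℤ ≡ (if s then a else 0ℤ) +ℤ 0ℤ +ℤ ((if s then b else 0ℤ) +ℤ 0ℤ)
        split true rewrite ℤP.+-identityʳ (a +ℤ b) | ℤP.+-identityʳ a | ℤP.+-identityʳ b = refl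
        split false = refl

K-* : ∀ a b → K (a *ℤ b) ≋ K a ⊛ K b
K-* a b = ·≋K⊛ a (K b)

K-0 : K 0ℤ ≋ 0P
K-0 = mk (λ m → vanish (sameMono (0ℤ , []) m))
  where vanish : ∀ s → (if s then 0ℤ else 0ℤ) +ℤ 0ℤ ≡ 0ℤ
        vanish true = refl
        vanish false = refl

K-cong : ∀ {a b} → a ≡ b → K a ≋ K b
K-cong refl = ≋-refl

K-neg : ∀ a → K (ℤ.- a) ≋ ⊝ K a
K-neg a rewrite ⊝-def (K a) = mk (λ m → negate (sameMono (0ℤ , []) m))
  where negate : ∀ s → (if s then ℤ.- a else 0ℤ) +ℤ 0ℤ ≡ (if s then -1ℤ *ℤ a else 0ℤ) +ℤ 0ℤ
        negate true = cong (_+ℤ 0ℤ) (sym (ℤP.-1*i≡-i a))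
        negate false = refl

R-almost : ACR.AlmostCommutativeRing _ _
R-almost = ACR.fromCommutativeRing R

K-homomorphism : ACR._-Raw-AlmostCommutative⟶_ ℤ.+-*-rawRing R-almost
K-homomorphism = record
  { ⟦_⟧ = K ; +-homo = K-+ ; *-homo = K-* ; -‿homo = K-neg ; 0-homo = K-0 ; 1-homo = ≋-refl }

K-equal? : ∀ a b → Maybe (K a ≋ K b)
K-equal? a b with a ℤ.≟ b
... | yes refl = just ≋-refl
... | no _ = nothing

open import Algebra.Solver.Ring ℤ.+-*-rawRing R-almost K-homomorphism K-equal?
  using (solve; _:=_; _:+_; _:*_; con)

Sum : (ℕ → Poly) → ℕ → Poly
Sum φ zero = 0P
Sum φ (suc n) = φ 0 ⊕ Sum (λ i → φ (suc i)) n

sumP-range : ∀ (f : ℕ → Poly) (g h : ℕ → ℕ) n → sumP (map f (map g (applyUpTo h n))) ≡ Sum (λ i → f (g (h i))) n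
sumP-range f g h zero = refl
sumP-range f g h (suc n) =
  trans (cong (f (g (h 0)) +P_) (sumP-range f g (λ i → h (suc i)) n)) (sym (⊕-def _ _))

Σ≡Sum : ∀ a b f → Σ[ a ⋯ b ] f ≡ Sum (λ i → f (a + i)) (suc b ∸ a)
Σ≡Sum a b f = sumP-range f (λ i → a + i) (λ i → i) (suc b ∸ a)

Sum-cong : ∀ n {φ ψ} → (∀ i → i < n → φ i ≋ ψ i) → Sum φ n ≋ Sum ψ n
Sum-cong zero h = ≋-refl
Sum-cong (suc n) h = +-cong (h 0 (s≤s z≤n)) (Sum-cong n (λ i lt → h (suc i) (s≤s lt)))

Sum-+ : ∀ n φ ψ → Sum (λ i → φ i ⊕ ψ i) n ≋ Sum φ n ⊕ Sum ψ n
Sum-+ zero φ ψ = ≋-sym (+-identityˡ 0P)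
Sum-+ (suc n) φ ψ = ≋-trans (+-cong ≋-refl (Sum-+ n _ _))
  (interchange (φ 0) (ψ 0) (Sum (λ i → φ (suc i)) n) (Sum (λ i → ψ (suc i)) n))
  where interchange : ∀ a b c d → (a ⊕ b) ⊕ (c ⊕ d) ≋ (a ⊕ c) ⊕ (b ⊕ d)
        interchange = solve 4 (λ a b c d → (a :+ b) :+ (c :+ d) := (a :+ c) :+ (b :+ d)) ≋-refl

Sum-*ˡ : ∀ n r φ → r ⊛ Sum φ n ≋ Sum (λ i → r ⊛ φ i) n
Sum-*ˡ zero r φ = zeroʳ r
Sum-*ˡ (suc n) r φ = ≋-trans (distribˡ r _ _) (+-cong ≋-refl (Sum-*ˡ n r _))

Sum-*ʳ : ∀ n r φ → Sum φ n ⊛ r ≋ Sum (λ i → φ i ⊛ r) n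
Sum-*ʳ n r φ = ≋-trans (*-comm _ r) (≋-trans (Sum-*ˡ n r φ) (Sum-cong n (λ i _ → *-comm r _)))

Sum-0 : ∀ n φ → (∀ i → i < n → φ i ≋ 0P) → Sum φ n ≋ 0P
Sum-0 zero φ h = ≋-refl
Sum-0 (suc n) φ h = ≋-trans (+-cong (h 0 (s≤s z≤n)) (Sum-0 n _ (λ i lt → h (suc i) (s≤s lt)))) (+-identityˡ 0P)

Sum-split : ∀ m r φ → Sum φ (m + r) ≋ Sum φ m ⊕ Sum (λ i → φ (m + i)) r
Sum-split zero r φ = ≋-sym (+-identityˡ _)
Sum-split (suc m) r φ = ≋-trans (+-cong ≋-refl (Sum-split m r _)) (≋-sym (+-assoc _ _ _))

Sum-snoc : ∀ n φ → Sum φ (suc n) ≋ Sum φ n ⊕ φ n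
Sum-snoc n φ = begin
  Sum φ (suc n)                ≡⟨ cong (Sum φ) (ℕP.+-comm 1 n) ⟩
  Sum φ (n + 1)                ≈⟨ Sum-split n 1 φ ⟩
  Sum φ n ⊕ (φ (n + 0) ⊕ 0P)   ≈⟨ +-cong ≋-refl (+-identityʳ _) ⟩
  Sum φ n ⊕ φ (n + 0)          ≡⟨ cong (λ k → Sum φ n ⊕ φ k) (ℕP.+-identityʳ n) ⟩
  Sum φ n ⊕ φ n                ∎
  where open ≋-Reasoning

nth-decAt-same : ∀ as i → nth (decAt as i) i ≡ nth as i ∸ 1
nth-decAt-same [] i = refl
nth-decAt-same (x ∷ as) zero = refl
nth-decAt-same (x ∷ as) (suc i) = nth-decAt-same as i

nth-decAt-other : ∀ as i j → ¬ i ≡ j → nth (decAt as i) j ≡ nth as j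
nth-decAt-other [] i j ne = refl
nth-decAt-other (x ∷ as) zero zero ne = ⊥-elim (ne refl)
nth-decAt-other (x ∷ as) zero (suc j) ne = refl
nth-decAt-other (x ∷ as) (suc i) zero ne = refl
nth-decAt-other (x ∷ as) (suc i) (suc j) ne = nth-decAt-other as i j (λ e → ne (cong suc e))

decAt-ext : ∀ as bs i → (∀ j → nth as j ≡ nth bs j) → ∀ j → nth (decAt as i) j ≡ nth (decAt bs i) j
decAt-ext as bs i h j with i ℕ.≟ j
... | yes refl = trans (nth-decAt-same as i) (trans (cong (_∸ 1) (h i)) (sym (nth-decAt-same bs i)))
... | no ne = trans (nth-decAt-other as i j ne) (trans (h j) (sym (nth-decAt-other bs i j ne)))

-- The partial derivative ∂ j is dual, under the pairing, to the operator
-- ∂-weight j on weights:  g ↦ (m ↦ (exponent of X_j in m) · g(m / X_j)).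

∂-weight : ℕ → (Mono → ℤ) → Mono → ℤ
∂-weight zero g m = 0ℤ
∂-weight (suc zero) g (e , as) = e *ℤ g (e -ℤ 1ℤ , as)
∂-weight (suc (suc i)) g (e , as) = + nth as i *ℤ g (e , decAt as i)

pairing-∂ : ∀ j p g → pairing (∂ j p) g ≡ pairing p (∂-weight j g)
pairing-∂ zero p g = sym (pairing-0 p)
pairing-∂ (suc zero) [] g = refl
pairing-∂ (suc zero) ((c , (e , as)) ∷ p) g = cong₂ _+ℤ_ (ℤP.*-assoc c e _) (pairing-∂ 1 p g)
pairing-∂ (suc (suc i)) [] g = refl
pairing-∂ (suc (suc i)) ((c , (e , as)) ∷ p) g = cong₂ _+ℤ_ (ℤP.*-assoc c (+ nth as i) _) (pairing-∂ (suc (suc i)) p g)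

∂-weight-invariant : ∀ j g → Invariant g → Invariant (∂-weight j g)
∂-weight-invariant zero g inv m m' h = refl
∂-weight-invariant (suc zero) g inv (e , as) (e' , bs) h rewrite ~-exp {e} {e'} {as} {bs} h =
  cong (e' *ℤ_) (inv (e' -ℤ 1ℤ , as) (e' -ℤ 1ℤ , bs) (~-intro _ _ as bs refl (~-nth {e} {e'} {as} {bs} h)))
∂-weight-invariant (suc (suc i)) g inv (e , as) (e' , bs) h rewrite ~-exp {e} {e'} {as} {bs} h | ~-nth {e} {e'} {as} {bs} h i =
  cong (+ nth bs i *ℤ_) (inv (e' , decAt as i) (e' , decAt bs i)
    (~-intro _ _ (decAt as i) (decAt bs i) refl (decAt-ext as bs i (~-nth {e} {e'} {as} {bs} h))))

∂-weight-pairing : ∀ j q (h : Mono → Mono → ℤ) m →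
  ∂-weight j (λ x → pairing q (h x)) m ≡ pairing q (λ y → ∂-weight j (λ x → h x y) m)
∂-weight-pairing zero q h m = sym (pairing-0 q)
∂-weight-pairing (suc zero) q h (e , as) = sym (pairing-* q e _)
∂-weight-pairing (suc (suc i)) q h (e , as) = sym (pairing-* q (+ nth as i) _)

coeff-∂ : ∀ j p m → coeff (∂ j p) m ≡ pairing p (∂-weight j (δ m))
coeff-∂ j p m = trans (coeff-pairing (∂ j p) m) (pairing-∂ j p (δ m))

∂-cong : ∀ j {p q} → p ≈ q → ∂ j p ≈ ∂ j q
∂-cong j {p} {q} e m = trans (coeff-∂ j p m)
  (trans (pairing-≈ p q e _ (∂-weight-invariant j (δ m) (δ-invariant m))) (sym (coeff-∂ j q m)))

∂-++ : ∀ j p q → ∂ j (p ++ q) ≡ ∂ j p ++ ∂ j q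
∂-++ zero p q = refl
∂-++ (suc zero) p q = LP.map-++ _ p q
∂-++ (suc (suc i)) p q = LP.map-++ _ p q

∂-[] : ∀ j → ∂ j [] ≡ []
∂-[] zero = refl
∂-[] (suc zero) = refl
∂-[] (suc (suc i)) = refl

split-weight : ∀ x y d₀ d₁ d₂ → (1 ≤ x → d₀ ≡ d₁) → (1 ≤ y → d₀ ≡ d₂) → + (x + y) *ℤ d₀ ≡ + x *ℤ d₁ +ℤ + y *ℤ d₂
split-weight zero zero d₀ d₁ d₂ h₁ h₂ = refl
split-weight (suc x) zero d₀ d₁ d₂ h₁ h₂ rewrite ℕP.+-identityʳ x | h₁ (s≤s z≤n) = sym (ℤP.+-identityʳ _)
split-weight zero (suc y) d₀ d₁ d₂ h₁ h₂ rewrite h₂ (s≤s z≤n) = sym (ℤP.+-identityˡ _)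
split-weight (suc x) (suc y) d₀ d₁ d₂ h₁ h₂ rewrite sym (h₁ (s≤s z≤n)) | sym (h₂ (s≤s z≤n)) | ℤP.pos-+ (suc x) (suc y) =
  ℤP.*-distribʳ-+ d₀ (+ suc x) (+ suc y)

decAt-addExpˡ : ∀ as bs i → 1 ≤ nth as i → ∀ j → nth (decAt (addExp as bs) i) j ≡ nth (addExp (decAt as i) bs) j
decAt-addExpˡ as bs i le j with i ℕ.≟ j
... | yes refl rewrite nth-decAt-same (addExp as bs) i | nth-addExp as bs i | nth-addExp (decAt as i) bs i | nth-decAt-same as i =
  pred-+ (nth as i) (nth bs i) le
  where pred-+ : ∀ x y → 1 ≤ x → x + y ∸ 1 ≡ x ∸ 1 + y
        pred-+ (suc x) y _ = refl
... | no ne rewrite nth-decAt-other (addExp as bs) i j ne | nth-addExp as bs j | nth-addExp (decAt as i) bs j | nth-decAt-other as i j ne = refl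

decAt-addExpʳ : ∀ as bs i → 1 ≤ nth bs i → ∀ j → nth (decAt (addExp as bs) i) j ≡ nth (addExp as (decAt bs i)) j
decAt-addExpʳ as bs i le j with i ℕ.≟ j
... | yes refl rewrite nth-decAt-same (addExp as bs) i | nth-addExp as bs i | nth-addExp as (decAt bs i) i | nth-decAt-same bs i =
  ℕP.+-∸-assoc (nth as i) le
... | no ne rewrite nth-decAt-other (addExp as bs) i j ne | nth-addExp as bs j | nth-addExp as (decAt bs i) j | nth-decAt-other bs i j ne = refl

lower-left : ∀ e f → e -ℤ 1ℤ +ℤ f ≡ e +ℤ f -ℤ 1ℤ
lower-left = solve-∀

lower-right : ∀ e f → e +ℤ (f -ℤ 1ℤ) ≡ e +ℤ f -ℤ 1ℤ
lower-right = solve-∀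

∂-weight-leibniz : ∀ j m m₁ m₂ →
  ∂-weight j (δ m) (mulMono m₁ m₂) ≡ ∂-weight j (λ x → δ m (mulMono x m₂)) m₁ +ℤ ∂-weight j (λ y → δ m (mulMono m₁ y)) m₂
∂-weight-leibniz zero m m₁ m₂ = refl
∂-weight-leibniz (suc zero) m (e , as) (f , bs) rewrite lower-left e f | lower-right e f = ℤP.*-distribʳ-+ _ e f
∂-weight-leibniz (suc (suc i)) m (e , as) (f , bs) rewrite nth-addExp as bs i =
  split-weight (nth as i) (nth bs i) _ _ _
    (λ le → δ-invariant m (e +ℤ f , decAt (addExp as bs) i) (e +ℤ f , addExp (decAt as i) bs)
              (~-intro _ _ (decAt (addExp as bs) i) (addExp (decAt as i) bs) refl (decAt-addExpˡ as bs i le)))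
    (λ le → δ-invariant m (e +ℤ f , decAt (addExp as bs) i) (e +ℤ f , addExp as (decAt bs i))
              (~-intro _ _ (decAt (addExp as bs) i) (addExp as (decAt bs i)) refl (decAt-addExpʳ as bs i le)))

∂-*P : ∀ j p q → ∂ j (p *P q) ≈ (∂ j p *P q) +P (p *P ∂ j q)
∂-*P j p q m = begin
    coeff (∂ j (p *P q)) m
  ≡⟨ trans (coeff-∂ j (p *P q) m) (pairing-*P p q (∂-weight j (δ m))) ⟩
    pairing p (λ m₁ → pairing q (λ m₂ → ∂-weight j (δ m) (mulMono m₁ m₂)))
  ≡⟨ pairing-cong p (λ m₁ → trans (pairing-cong q (∂-weight-leibniz j m m₁)) (pairing-+ q _ _)) ⟩
    pairing p (λ m₁ → pairing q (λ m₂ → ∂-weight j (λ x → δ m (mulMono x m₂)) m₁)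
                      +ℤ pairing q (λ m₂ → ∂-weight j (λ y → δ m (mulMono m₁ y)) m₂))
  ≡⟨ pairing-+ p _ _ ⟩
    pairing p (λ m₁ → pairing q (λ m₂ → ∂-weight j (λ x → δ m (mulMono x m₂)) m₁))
      +ℤ pairing p (λ m₁ → pairing q (∂-weight j (λ y → δ m (mulMono m₁ y))))
  ≡⟨ cong₂ _+ℤ_ (trans (pairing-cong p (λ m₁ → sym (∂-weight-pairing j q (λ x y → δ m (mulMono x y)) m₁)))
                          (sym (pairing-∂ j p _)))
                (pairing-cong p (λ m₁ → sym (pairing-∂ j q _))) ⟩
    pairing (∂ j p) (λ m₁ → pairing q (λ m₂ → δ m (mulMono m₁ m₂)))
      +ℤ pairing p (λ m₁ → pairing (∂ j q) (λ m₂ → δ m (mulMono m₁ m₂)))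
  ≡⟨ sym (trans (coeff-++ (∂ j p *P q) (p *P ∂ j q) m) (cong₂ _+ℤ_ (coeff-*P (∂ j p) q m) (coeff-*P p (∂ j q) m))) ⟩
    coeff ((∂ j p *P q) +P (p *P ∂ j q)) m
  ∎
  where open ≡.≡-Reasoning

∂-cong≋ : ∀ j {p q} → p ≋ q → ∂ j p ≋ ∂ j q
∂-cong≋ j e = mk (∂-cong j (un e))

∂-⊕ : ∀ j p q → ∂ j (p ⊕ q) ≋ ∂ j p ⊕ ∂ j q
∂-⊕ j p q rewrite ⊕-def p q | ⊕-def (∂ j p) (∂ j q) = ≡⇒≋ (∂-++ j p q)

∂-⊛ : ∀ j p q → ∂ j (p ⊛ q) ≋ (∂ j p ⊛ q) ⊕ (p ⊛ ∂ j q)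
∂-⊛ j p q rewrite ⊛-def p q | ⊛-def (∂ j p) q | ⊛-def p (∂ j q) | ⊕-def (∂ j p *P q) (p *P ∂ j q) = mk (∂-*P j p q)

∂-K : ∀ j a → ∂ j (K a) ≋ 0P
∂-K zero a = ≋-refl
∂-K (suc zero) a = mk (λ m → vanish (sameMono (0ℤ -ℤ 1ℤ , []) m))
  where vanish : ∀ s → (if s then a *ℤ 0ℤ else 0ℤ) +ℤ 0ℤ ≡ 0ℤ
        vanish true = trans (ℤP.+-identityʳ _) (ℤP.*-zeroʳ a)
        vanish false = refl
∂-K (suc (suc i)) a = mk (λ m → vanish (sameMono (0ℤ , decAt [] i) m))
  where vanish : ∀ s → (if s then a *ℤ 0ℤ else 0ℤ) +ℤ 0ℤ ≡ 0ℤ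
        vanish true = trans (ℤP.+-identityʳ _) (ℤP.*-zeroʳ a)
        vanish false = refl

∂-X₁ : ∀ i → ∂ (suc (suc i)) (X 1) ≋ 0P
∂-X₁ i = mk (λ m → vanish (sameMono (+ 1 , decAt [] i) m))
  where vanish : ∀ s → (if s then 1ℤ *ℤ 0ℤ else 0ℤ) +ℤ 0ℤ ≡ 0ℤ
        vanish true = refl
        vanish false = refl

D : ℕ → Poly → Poly
D N p = Sum (λ i → X (suc (suc i)) ⊛ ∂ (suc i) p) N

Σ≋D : ∀ N p → Σ[ 1 ⋯ N ] (λ j → X (suc j) *P ∂ j p) ≋ D N p
Σ≋D N p = ≋-trans (≡⇒≋ (Σ≡Sum 1 N (λ j → X (suc j) *P ∂ j p))) (Sum-cong N (λ i _ → ≡⇒≋ (sym (⊛-def _ _))))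

D-cong : ∀ N {p q} → p ≋ q → D N p ≋ D N q
D-cong N e = Sum-cong N (λ i _ → *-cong ≋-refl (∂-cong≋ (suc i) e))

D-⊕ : ∀ N p q → D N (p ⊕ q) ≋ D N p ⊕ D N q
D-⊕ N p q = ≋-trans (Sum-cong N (λ i _ → ≋-trans (*-cong ≋-refl (∂-⊕ (suc i) p q)) (distribˡ _ _ _))) (Sum-+ N _ _)

D-⊛ : ∀ N p q → D N (p ⊛ q) ≋ (D N p ⊛ q) ⊕ (p ⊛ D N q)
D-⊛ N p q = begin
    D N (p ⊛ q)
  ≈⟨ Sum-cong N (λ i _ → ≋-trans (*-cong ≋-refl (∂-⊛ (suc i) p q)) (spread _ _ _ _ _)) ⟩
    Sum (λ i → ((X (suc (suc i)) ⊛ ∂ (suc i) p) ⊛ q) ⊕ (p ⊛ (X (suc (suc i)) ⊛ ∂ (suc i) q))) N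
  ≈⟨ Sum-+ N _ _ ⟩
    Sum (λ i → (X (suc (suc i)) ⊛ ∂ (suc i) p) ⊛ q) N ⊕ Sum (λ i → p ⊛ (X (suc (suc i)) ⊛ ∂ (suc i) q)) N
  ≈⟨ +-cong (≋-sym (Sum-*ʳ N q _)) (≋-sym (Sum-*ˡ N p _)) ⟩
    (D N p ⊛ q) ⊕ (p ⊛ D N q)
  ∎
  where
    open ≋-Reasoning
    spread : ∀ x a b p q → x ⊛ ((a ⊛ q) ⊕ (p ⊛ b)) ≋ ((x ⊛ a) ⊛ q) ⊕ (p ⊛ (x ⊛ b))
    spread = solve 5 (λ x a b p q → x :* ((a :* q) :+ (p :* b)) := ((x :* a) :* q) :+ (p :* (x :* b))) ≋-refl

D-K : ∀ N a → D N (K a) ≋ 0P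
D-K N a = Sum-0 N _ (λ i _ → ≋-trans (*-cong ≋-refl (∂-K (suc i) a)) (zeroʳ _))

D-0 : ∀ N → D N 0P ≋ 0P
D-0 N = Sum-0 N _ (λ i _ → ≋-trans (*-cong ≋-refl (≡⇒≋ (∂-[] (suc i)))) (zeroʳ _))

D-X₁ : ∀ N → D (suc N) (X 1) ≋ X 2
D-X₁ N = ≋-trans (+-cong (*-identityʳ (X 2)) (Sum-0 N _ (λ i _ → ≋-trans (*-cong ≋-refl (∂-X₁ i)) (zeroʳ _))))
                 (+-identityʳ _)

D-Sum : ∀ N n φ → D N (Sum φ n) ≋ Sum (λ i → D N (φ i)) n
D-Sum N zero φ = D-0 N
D-Sum N (suc n) φ = ≋-trans (D-⊕ N _ _) (+-cong ≋-refl (D-Sum N n _))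

D-scaled-⊛ : ∀ N c a b → D N (K c ⊛ (a ⊛ b)) ≋ K c ⊛ ((D N a ⊛ b) ⊕ (a ⊛ D N b))
D-scaled-⊛ N c a b = ≋-trans (D-⊛ N (K c) (a ⊛ b))
  (≋-trans (+-cong (≋-trans (*-cong (D-K N c) ≋-refl) (zeroˡ _)) (*-cong ≋-refl (D-⊛ N a b))) (+-identityˡ _))

-- Bounds on the variables: 'InVars L p' says that p only involves
-- X₁, X₂, …, X_{L+1}.  Then ∂ j p = 0 for j > L+1, so that D_N p does
-- not depend on N ≥ L+1.

InVars : ℕ → Poly → Set
InVars L p = All (λ t → length (proj₂ (proj₂ t)) ≤ L) p

nth-beyond : ∀ as i → length as ≤ i → nth as i ≡ 0
nth-beyond [] i le = refl
nth-beyond (x ∷ as) (suc i) (s≤s le) = nth-beyond as i le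

∂-beyond : ∀ L i p → InVars L p → L ≤ i → ∂ (suc (suc i)) p ≋ 0P
∂-beyond L i p V le = mk (λ m → trans (coeff-∂ (suc (suc i)) p m) (vanish (δ m) p V))
  where
    vanish : ∀ g p → InVars L p → pairing p (∂-weight (suc (suc i)) g) ≡ 0ℤ
    vanish g [] [] = refl
    vanish g ((c , (e , as)) ∷ p) (h ∷ hs) rewrite nth-beyond as i (ℕP.≤-trans h le) | vanish g p hs =
      trans (ℤP.+-identityʳ _) (ℤP.*-zeroʳ c)

D-stable : ∀ L N p → InVars L p → suc L ≤ N → D N p ≋ D (suc L) p
D-stable L N p V le = begin
    D N p
  ≡⟨ cong (λ z → D z p) (sym (ℕP.m+[n∸m]≡n le)) ⟩
    D (suc L + (N ∸ suc L)) p
  ≈⟨ Sum-split (suc L) (N ∸ suc L) (λ i → X (suc (suc i)) ⊛ ∂ (suc i) p) ⟩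
    D (suc L) p ⊕ Sum (λ i → X (suc (suc (suc L + i))) ⊛ ∂ (suc (suc L + i)) p) (N ∸ suc L)
  ≈⟨ +-cong ≋-refl (Sum-0 (N ∸ suc L) _ (λ i _ → ≋-trans (*-cong ≋-refl (∂-beyond L (L + i) p V (ℕP.m≤m+n L i))) (zeroʳ _))) ⟩
    D (suc L) p ⊕ 0P
  ≈⟨ +-identityʳ _ ⟩
    D (suc L) p
  ∎
  where open ≋-Reasoning

InVars-mono : ∀ {L L' p} → L ≤ L' → InVars L p → InVars L' p
InVars-mono le V = All.map (λ h → ℕP.≤-trans h le) V

InVars-++ : ∀ {L p q} → InVars L p → InVars L q → InVars L (p ++ q)
InVars-++ = AllP.++⁺

InVars-· : ∀ {L} a p → InVars L p → InVars L (a · p)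
InVars-· a [] [] = []
InVars-· a ((c , (e , as)) ∷ p) (h ∷ hs) = h ∷ InVars-· a p hs

length-addExp : ∀ as bs → length (addExp as bs) ≤ length as ⊔ length bs
length-addExp [] bs = ℕP.≤-refl
length-addExp (x ∷ as) [] = ℕP.≤-refl
length-addExp (x ∷ as) (y ∷ bs) = s≤s (length-addExp as bs)

InVars-*P : ∀ {L₁ L₂} p q → InVars L₁ p → InVars L₂ q → InVars (L₁ ⊔ L₂) (p *P q)
InVars-*P [] q [] Vq = []
InVars-*P ((c , (e , as)) ∷ p) q (h ∷ hs) Vq rewrite *P-cons c (e , as) p q =
  InVars-++ (term q Vq) (InVars-*P p q hs Vq)
  where
    term : ∀ q → InVars _ q → InVars _ (((c , (e , as)) ∷ []) *P q)
    term [] [] = []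
    term ((d , (f , bs)) ∷ q) (h' ∷ hs') = ℕP.≤-trans (length-addExp as bs) (ℕP.⊔-mono-≤ h h') ∷ term q hs'

length-decAt : ∀ as i → length (decAt as i) ≡ length as
length-decAt [] i = refl
length-decAt (x ∷ as) zero = refl
length-decAt (x ∷ as) (suc i) = cong suc (length-decAt as i)

InVars-∂ : ∀ {L} j p → InVars L p → InVars L (∂ j p)
InVars-∂ zero p V = []
InVars-∂ (suc zero) [] [] = []
InVars-∂ (suc zero) ((c , (e , as)) ∷ p) (h ∷ hs) = h ∷ InVars-∂ 1 p hs
InVars-∂ (suc (suc i)) [] [] = []
InVars-∂ (suc (suc i)) ((c , (e , as)) ∷ p) (h ∷ hs) =
  ℕP.≤-trans (ℕP.≤-reflexive (length-decAt as i)) h ∷ InVars-∂ (suc (suc i)) p hs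

InVars-X : ∀ i → InVars (suc i) (X (suc (suc i)))
InVars-X i = ℕP.≤-reflexive (length-X i) ∷ []
  where length-X : ∀ i → length (replicate i 0 ++ (1 ∷ [])) ≡ suc i
        length-X zero = refl
        length-X (suc i) = cong suc (length-X i)

InVars-Sum : ∀ {L} n φ → (∀ i → i < n → InVars L (φ i)) → InVars L (Sum φ n)
InVars-Sum zero φ h = []
InVars-Sum (suc n) φ h rewrite ⊕-def (φ 0) (Sum (λ i → φ (suc i)) n) =
  InVars-++ (h 0 (s≤s z≤n)) (InVars-Sum n _ (λ i lt → h (suc i) (s≤s lt)))

S-vanish : ∀ n k → n < k → S n k ≡ 0P
S-vanish zero (suc k) lt = refl
S-vanish (suc n) (suc k) (s≤s lt) rewrite dec-false (k ℕ.≤? n) (ℕP.<⇒≱ lt) = refl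

S-column-0 : ∀ n → 0 < n → S n 0 ≡ 0P
S-column-0 (suc n) _ = refl

-- The coefficient  -(2n-1) = 1 - 2n  of X₂ S_{n,k} in the recursion.
α : ℕ → ℤ
α n = (+ 1) -ℤ (+ (2 * n))

S-unfold : ∀ n k → k ≤ n → S (suc n) (suc k) ≡
  (α n · (X 2 *P S n (suc k))) +P X 1 *P (S n k +P Σ[ 1 ⋯ n ∸ suc k + 1 ] (λ j → X (suc j) *P ∂ j (S n (suc k))))
S-unfold n k le rewrite dec-true (k ℕ.≤? n) le = refl

S-unfold≋ : ∀ n k → k ≤ n →
  S (suc n) (suc k) ≋ (K (α n) ⊛ (X 2 ⊛ S n (suc k))) ⊕ (X 1 ⊛ (S n k ⊕ D (n ∸ suc k + 1) (S n (suc k))))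
S-unfold≋ n k le rewrite S-unfold n k le
  | sym (⊛-def (X 2) (S n (suc k)))
  | sym (⊕-def (S n k) (Σ[ 1 ⋯ n ∸ suc k + 1 ] (λ j → X (suc j) *P ∂ j (S n (suc k)))))
  | sym (⊛-def (X 1) (S n k ⊕ Σ[ 1 ⋯ n ∸ suc k + 1 ] (λ j → X (suc j) *P ∂ j (S n (suc k)))))
  = ≋-trans (≡⇒≋ (sym (⊕-def _ _)))
            (+-cong (·≋K⊛ _ _) (*-cong ≋-refl (+-cong ≋-refl (Σ≋D (n ∸ suc k + 1) (S n (suc k))))))

pred-∸ : ∀ n k → k < n → suc (n ∸ suc k) ≡ n ∸ k
pred-∸ (suc n) zero lt = refl
pred-∸ (suc n) (suc k) (s≤s lt) = pred-∸ n k lt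

S-InVars : ∀ n k → InVars (n ∸ k) (S n k)
S-InVars zero zero = z≤n ∷ []
S-InVars zero (suc k) = []
S-InVars (suc n) zero = []
S-InVars (suc n) (suc k) with k ℕ.≤? n
... | no k≰n rewrite S-vanish (suc n) (suc k) (s≤s (ℕP.≰⇒> k≰n)) = []
... | yes k≤n rewrite S-unfold n k k≤n =
  InVars-++ (InVars-· (α n) _ (term-X₂ k≤n))
            (InVars-*P (X 1) _ (z≤n ∷ []) (InVars-++ (S-InVars n k) (term-D k≤n)))
  where
    -- the terms involving S_{n,k+1} vanish unless k < n
    below : ∀ {L} (p : Poly → Poly) → InVars L (p 0P) → (k < n → InVars L (p (S n (suc k)))) →
            k ≤ n → InVars L (p (S n (suc k)))
    below {L} p base step k≤n with k ℕ.≟ n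
    ... | yes refl rewrite S-vanish k (suc k) (ℕP.n<1+n k) = base
    ... | no k≢n = step (ℕP.≤∧≢⇒< k≤n k≢n)
    term-X₂ : k ≤ n → InVars (n ∸ k) (X 2 *P S n (suc k))
    term-X₂ = below (X 2 *P_) []
      (λ k<n → InVars-mono (ℕP.⊔-lub (ℕP.≤-trans (s≤s z≤n) (ℕP.≤-reflexive (pred-∸ n k k<n))) (ℕP.∸-monoʳ-≤ n (ℕP.n≤1+n k)))
                           (InVars-*P (X 2) (S n (suc k)) (InVars-X 0) (S-InVars n (suc k))))
    term-D : k ≤ n → InVars (n ∸ k) (Σ[ 1 ⋯ n ∸ suc k + 1 ] (λ j → X (suc j) *P ∂ j (S n (suc k))))
    term-D k≤n rewrite Σ≡Sum 1 (n ∸ suc k + 1) (λ j → X (suc j) *P ∂ j (S n (suc k))) = InVars-Sum _ _ summand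
      where
        summand : ∀ i → i < suc (n ∸ suc k + 1) ∸ 1 → InVars (n ∸ k) (X (suc (suc i)) *P ∂ (suc i) (S n (suc k)))
        summand i i<N = below (λ s → X (suc (suc i)) *P ∂ (suc i) s)
          (subst (λ q → InVars (n ∸ k) (X (suc (suc i)) *P q)) (sym (∂-[] (suc i))) [])
          (λ k<n → InVars-mono (ℕP.⊔-lub (ℕP.≤-trans i<N (ℕP.≤-reflexive (trans (ℕP.+-comm (n ∸ suc k) 1) (pred-∸ n k k<n))))
                                        (ℕP.∸-monoʳ-≤ n (ℕP.n≤1+n k)))
                               (InVars-*P (X (suc (suc i))) _ (InVars-X i) (InVars-∂ (suc i) _ (S-InVars n (suc k)))))
          k≤n

-- The recursion holds for every k (both sides vanish when k > m), and by
-- the bound on variables the truncated derivation may be replaced by any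
-- longer one.
S-recursion : ∀ m k N → suc (m ∸ suc k) ≤ N →
  S (suc m) (suc k) ≋ (K (α m) ⊛ (X 2 ⊛ S m (suc k))) ⊕ (X 1 ⊛ (S m k ⊕ D N (S m (suc k))))
S-recursion m k N le with k ℕ.≤? m
... | yes k≤m = ≋-trans (S-unfold≋ m k k≤m) (+-cong ≋-refl (*-cong ≋-refl (+-cong ≋-refl
      (≋-trans (D-stable (m ∸ suc k) (m ∸ suc k + 1) (S m (suc k)) (S-InVars m (suc k)) (ℕP.≤-reflexive (ℕP.+-comm 1 (m ∸ suc k))))
               (≋-sym (D-stable (m ∸ suc k) N (S m (suc k)) (S-InVars m (suc k)) le))))))
... | no k≰m rewrite S-vanish (suc m) (suc k) (s≤s (ℕP.≰⇒> k≰m)) | S-vanish m (suc k) (ℕP.m<n⇒m<1+n (ℕP.≰⇒> k≰m))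
                   | S-vanish m k (ℕP.≰⇒> k≰m) =
  ≋-sym (≋-trans (+-cong (≋-trans (*-cong ≋-refl (zeroʳ _)) (zeroʳ _))
                         (≋-trans (*-cong ≋-refl (≋-trans (+-identityˡ _) (D-0 N))) (zeroʳ _)))
                 (+-identityˡ _))

-- The convolution on the right of (i), with the index shifted to i = j-1
-- and extended to all 0 ≤ i < n.
Conv : ℕ → ℕ → Poly
Conv n k = X 1 ⊛ Sum (λ i → K (binom (n ∸ 1) i) ⊛ (S (suc i) 1 ⊛ S (n ∸ suc i) (k ∸ 1))) n

-- For k = 1 only the last term, X₁ S_{n,1} S_{0,0} = S_{n,1}, survives.
Conv-1 : ∀ n → S (suc n) 1 ≋ Conv (suc n) 1
Conv-1 n = ≋-sym (begin
    X 1 ⊛ Sum φ (suc n)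
  ≈⟨ *-cong ≋-refl (≋-trans (Sum-snoc n φ) (≋-trans (+-cong (Sum-0 n φ early) ≋-refl) (+-identityˡ _))) ⟩
    X 1 ⊛ φ n
  ≡⟨ cong (λ z → X 1 ⊛ (K (+ (n C n)) ⊛ (S (suc n) 1 ⊛ S z 0))) (ℕP.n∸n≡0 n) ⟩
    X 1 ⊛ (K (+ (n C n)) ⊛ (S (suc n) 1 ⊛ X₁⁻¹))
  ≡⟨ cong (λ z → X 1 ⊛ (K (+ z) ⊛ (S (suc n) 1 ⊛ X₁⁻¹))) (nCn≡1 n) ⟩
    X 1 ⊛ (1P ⊛ (S (suc n) 1 ⊛ X₁⁻¹))
  ≈⟨ rearrange (X 1) (S (suc n) 1) X₁⁻¹ ⟩
    S (suc n) 1 ⊛ (X 1 ⊛ X₁⁻¹)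
  ≈⟨ *-cong ≋-refl (≡⇒≋ (⊛-def (X 1) X₁⁻¹)) ⟩
    S (suc n) 1 ⊛ 1P
  ≈⟨ *-identityʳ _ ⟩
    S (suc n) 1
  ∎)
  where
    open ≋-Reasoning
    φ : ℕ → Poly
    φ i = K (binom n i) ⊛ (S (suc i) 1 ⊛ S (n ∸ i) 0)
    early : ∀ i → i < n → φ i ≋ 0P
    early i i<n rewrite S-column-0 (n ∸ i) (ℕP.m<n⇒0<n∸m i<n) = ≋-trans (*-cong ≋-refl (zeroʳ _)) (zeroʳ _)
    rearrange : ∀ x s y → x ⊛ (1P ⊛ (s ⊛ y)) ≋ s ⊛ (x ⊛ y)
    rearrange = solve 3 (λ x s y → x :* (con 1ℤ :* (s :* y)) := s :* (x :* y)) ≋-refl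

pascal-Sum : ∀ m (F : ℕ → Poly) →
  Sum (λ i → K (binom m i) ⊛ (F (suc i) ⊕ F i)) (suc m) ≋ Sum (λ i → K (binom (suc m) i) ⊛ F i) (suc (suc m))
pascal-Sum m F = ≋-sym (begin
    (c 0 ⊛ F 0) ⊕ Sum (λ i → K (binom (suc m) (suc i)) ⊛ F (suc i)) (suc m)
  ≈⟨ +-cong ≋-refl (Sum-cong (suc m) (λ i _ → *-cong (pascal i) (≋-refl {F (suc i)}))) ⟩
    (c 0 ⊛ F 0) ⊕ Sum (λ i → (c i ⊕ c (suc i)) ⊛ F (suc i)) (suc m)
  ≈⟨ +-cong ≋-refl (≋-trans (Sum-cong (suc m) (λ i _ → distribʳ (F (suc i)) (c i) (c (suc i))))
                            (Sum-+ (suc m) (λ i → c i ⊛ F (suc i)) (λ i → c (suc i) ⊛ F (suc i)))) ⟩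
    (c 0 ⊛ F 0) ⊕ (Sum (λ i → c i ⊛ F (suc i)) (suc m) ⊕ Sum (λ i → c (suc i) ⊛ F (suc i)) (suc m))
  ≈⟨ exchange (c 0 ⊛ F 0) (Sum (λ i → c i ⊛ F (suc i)) (suc m)) (Sum (λ i → c (suc i) ⊛ F (suc i)) (suc m)) ⟩
    Sum (λ i → c i ⊛ F (suc i)) (suc m) ⊕ Sum (λ i → c i ⊛ F i) (suc (suc m))
  ≈⟨ +-cong ≋-refl (≋-trans (Sum-snoc (suc m) (λ i → c i ⊛ F i))
                            (≋-trans (+-cong ≋-refl (≋-trans (*-cong top ≋-refl) (zeroˡ _))) (+-identityʳ _))) ⟩
    Sum (λ i → c i ⊛ F (suc i)) (suc m) ⊕ Sum (λ i → c i ⊛ F i) (suc m)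
  ≈⟨ ≋-sym (≋-trans (Sum-cong (suc m) (λ i _ → distribˡ (c i) (F (suc i)) (F i)))
                    (Sum-+ (suc m) (λ i → c i ⊛ F (suc i)) (λ i → c i ⊛ F i))) ⟩
    Sum (λ i → c i ⊛ (F (suc i) ⊕ F i)) (suc m)
  ∎)
  where
    open ≋-Reasoning
    c : ℕ → Poly
    c i = K (binom m i)
    pascal : ∀ i → K (binom (suc m) (suc i)) ≋ c i ⊕ c (suc i)
    pascal i = ≋-trans (K-cong (trans (cong +_ (sym (nCk+nC[k+1]≡[n+1]C[k+1] m i))) (ℤP.pos-+ (m C i) (m C suc i))))
                       (K-+ (+ (m C i)) (+ (m C suc i)))
    top : c (suc m) ≋ 0P
    top = ≋-trans (K-cong (cong +_ (k>n⇒nCk≡0 (ℕP.n<1+n m)))) K-0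
    exchange : ∀ a b d → a ⊕ (b ⊕ d) ≋ b ⊕ (a ⊕ d)
    exchange = solve 3 (λ a b d → a :+ (b :+ d) := b :+ (a :+ d)) ≋-refl

α-double : ∀ x → α x ≡ 1ℤ -ℤ (+ x +ℤ + x)
α-double x = cong (1ℤ -ℤ_) (trans (cong +_ (cong (λ y → x + y) (ℕP.+-identityʳ x))) (ℤP.pos-+ x x))

α-split : ∀ i j → α (suc (i + j)) +ℤ 1ℤ ≡ α (suc i) +ℤ α j
α-split i j rewrite α-double (suc (i + j)) | α-double (suc i) | α-double j
                  | ℤP.pos-+ 1 (i + j) | ℤP.pos-+ i j | ℤP.pos-+ 1 i =
  identity (+ i) (+ j)
  where
    identity : ∀ a b → 1ℤ -ℤ ((1ℤ +ℤ (a +ℤ b)) +ℤ (1ℤ +ℤ (a +ℤ b))) +ℤ 1ℤ ≡ 1ℤ -ℤ ((1ℤ +ℤ a) +ℤ (1ℤ +ℤ a)) +ℤ (1ℤ -ℤ (b +ℤ b))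
    identity = solve-∀

Sum-linear : ∀ n (u v : Poly) φ ψ → Sum (λ i → (u ⊛ φ i) ⊕ (v ⊛ ψ i)) n ≋ (u ⊛ Sum φ n) ⊕ (v ⊛ Sum ψ n)
Sum-linear n u v φ ψ = ≋-trans (Sum-+ n _ _) (+-cong (≋-sym (Sum-*ˡ n u φ)) (≋-sym (Sum-*ˡ n v ψ)))

-- Induction step: (i) for (n, k+2) and (n, k+1) implies (i) for
-- (n+1, k+2), where n = m+1.  With c_i = C(m,i), U_i = S_{i+1,1},
-- V_i = S_{n-i-1,k+1}, V'_i = S_{n-i-1,k} the hypotheses read
-- S_{n,k+2} = X₁ Σ c_i U_i V_i and S_{n,k+1} = X₁ Σ c_i U_i V'_i.  Feeding
-- them into the recursion for S_{n+1,k+2} and expanding D by Leibniz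
-- gives X₁ Σ c_i W_i; the recursions for U⁺_i = S_{i+2,1} and for
-- V⁺_i = S_{n-i,k+1} identify W_i with U⁺_i V_i + U_i V⁺_i, and Pascal's
-- rule finishes.
module InductionStep (m k : ℕ) where

  n : ℕ
  n = suc m

  c U V V' DU DV U⁺ V⁺ : ℕ → Poly
  c i = K (binom m i)
  U i = S (suc i) 1
  V i = S (n ∸ suc i) (suc k)
  V' i = S (n ∸ suc i) k
  DU i = D n (U i)
  DV i = D n (V i)
  U⁺ i = S (suc (suc i)) 1
  V⁺ i = S (suc (n ∸ suc i)) (suc k)

  γ : Poly
  γ = K (α n)

  recursion-U⁺ : ∀ i → i < n → U⁺ i ≋ (K (α (suc i)) ⊛ (X 2 ⊛ U i)) ⊕ (X 1 ⊛ DU i)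
  recursion-U⁺ i i<n = ≋-trans (S-recursion (suc i) 0 n i<n) (+-cong ≋-refl (*-cong ≋-refl (+-identityˡ _)))

  recursion-V⁺ : ∀ i → i < n → V⁺ i ≋ (K (α (n ∸ suc i)) ⊛ (X 2 ⊛ V i)) ⊕ (X 1 ⊛ (V' i ⊕ DV i))
  recursion-V⁺ i i<n = S-recursion (n ∸ suc i) k n (s≤s (ℕP.≤-trans (ℕP.m∸n≤m (m ∸ i) (suc k)) (ℕP.m∸n≤m m i)))

  coefficients : ∀ i → i < n → γ ⊕ 1P ≋ K (α (suc i)) ⊕ K (α (n ∸ suc i))
  coefficients i (s≤s i≤m) = begin
      K (α n) ⊕ K 1ℤ                    ≈⟨ ≋-sym (K-+ _ _) ⟩
      K (α n +ℤ 1ℤ)                     ≡⟨ cong (λ z → K (α (suc z) +ℤ 1ℤ)) (sym (ℕP.m+[n∸m]≡n i≤m)) ⟩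
      K (α (suc (i + (m ∸ i))) +ℤ 1ℤ)   ≡⟨ cong K (α-split i (m ∸ i)) ⟩
      K (α (suc i) +ℤ α (m ∸ i))        ≈⟨ K-+ _ _ ⟩
      K (α (suc i)) ⊕ K (α (m ∸ i))     ∎
    where open ≋-Reasoning

  W : ℕ → Poly
  W i = ((γ ⊕ 1P) ⊛ (X 2 ⊛ (U i ⊛ V i))) ⊕ (X 1 ⊛ ((U i ⊛ V' i) ⊕ ((DU i ⊛ V i) ⊕ (U i ⊛ DV i))))

  regroup : ∀ i → i < n → W i ≋ (U⁺ i ⊛ V i) ⊕ (U i ⊛ V⁺ i)
  regroup i i<n = ≋-sym (begin
      (U⁺ i ⊛ V i) ⊕ (U i ⊛ V⁺ i)
    ≈⟨ +-cong (*-cong (recursion-U⁺ i i<n) ≋-refl) (*-cong ≋-refl (recursion-V⁺ i i<n)) ⟩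
      (((K (α (suc i)) ⊛ (X 2 ⊛ U i)) ⊕ (X 1 ⊛ DU i)) ⊛ V i)
        ⊕ (U i ⊛ ((K (α (n ∸ suc i)) ⊛ (X 2 ⊛ V i)) ⊕ (X 1 ⊛ (V' i ⊕ DV i))))
    ≈⟨ expand (K (α (suc i))) (K (α (n ∸ suc i))) (X 1) (X 2) (U i) (V i) (V' i) (DU i) (DV i) ⟩
      ((K (α (suc i)) ⊕ K (α (n ∸ suc i))) ⊛ (X 2 ⊛ (U i ⊛ V i)))
        ⊕ (X 1 ⊛ ((U i ⊛ V' i) ⊕ ((DU i ⊛ V i) ⊕ (U i ⊛ DV i))))
    ≈⟨ +-cong (*-cong (≋-sym (coefficients i i<n)) ≋-refl) ≋-refl ⟩
      W i
    ∎)
    where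
      open ≋-Reasoning
      expand : ∀ a b x₁ x₂ a' b' c' da db →
        (((a ⊛ (x₂ ⊛ a')) ⊕ (x₁ ⊛ da)) ⊛ b') ⊕ (a' ⊛ ((b ⊛ (x₂ ⊛ b')) ⊕ (x₁ ⊛ (c' ⊕ db))))
        ≋ ((a ⊕ b) ⊛ (x₂ ⊛ (a' ⊛ b'))) ⊕ (x₁ ⊛ ((a' ⊛ c') ⊕ ((da ⊛ b') ⊕ (a' ⊛ db))))
      expand = solve 9 (λ a b x₁ x₂ a' b' c' da db →
        (((a :* (x₂ :* a')) :+ (x₁ :* da)) :* b') :+ (a' :* ((b :* (x₂ :* b')) :+ (x₁ :* (c' :+ db))))
        := ((a :+ b) :* (x₂ :* (a' :* b'))) :+ (x₁ :* ((a' :* c') :+ ((da :* b') :+ (a' :* db))))) ≋-refl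

  ΣUV ΣUV' ΣD : Poly
  ΣUV = Sum (λ i → c i ⊛ (U i ⊛ V i)) n
  ΣUV' = Sum (λ i → c i ⊛ (U i ⊛ V' i)) n
  ΣD = Sum (λ i → c i ⊛ ((DU i ⊛ V i) ⊕ (U i ⊛ DV i))) n

  D-X₁ΣUV : D n (X 1 ⊛ ΣUV) ≋ (X 2 ⊛ ΣUV) ⊕ (X 1 ⊛ ΣD)
  D-X₁ΣUV = ≋-trans (D-⊛ n (X 1) ΣUV) (+-cong (*-cong (D-X₁ m) ≋-refl)
    (*-cong ≋-refl (≋-trans (D-Sum n n (λ i → c i ⊛ (U i ⊛ V i))) (Sum-cong n (λ i _ → D-scaled-⊛ n (binom m i) (U i) (V i))))))

  Sum-W : Sum (λ i → c i ⊛ W i) n ≋ (((γ ⊕ 1P) ⊛ X 2) ⊛ ΣUV) ⊕ (X 1 ⊛ (ΣUV' ⊕ ΣD))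
  Sum-W = ≋-trans (Sum-cong n (λ i _ → distribute (c i) (γ ⊕ 1P) (X 1) (X 2) (U i) (V i) (V' i) (DU i) (DV i)))
    (≋-trans (Sum-linear n ((γ ⊕ 1P) ⊛ X 2) (X 1) t₁ (λ i → t₂ i ⊕ t₃ i)) (+-cong ≋-refl (*-cong ≋-refl (Sum-+ n t₂ t₃))))
    where
      t₁ t₂ t₃ : ℕ → Poly
      t₁ i = c i ⊛ (U i ⊛ V i)
      t₂ i = c i ⊛ (U i ⊛ V' i)
      t₃ i = c i ⊛ ((DU i ⊛ V i) ⊕ (U i ⊛ DV i))
      distribute : ∀ c g x₁ x₂ a b c' da db →
        c ⊛ ((g ⊛ (x₂ ⊛ (a ⊛ b))) ⊕ (x₁ ⊛ ((a ⊛ c') ⊕ ((da ⊛ b) ⊕ (a ⊛ db)))))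
        ≋ ((g ⊛ x₂) ⊛ (c ⊛ (a ⊛ b))) ⊕ (x₁ ⊛ ((c ⊛ (a ⊛ c')) ⊕ (c ⊛ ((da ⊛ b) ⊕ (a ⊛ db)))))
      distribute = solve 9 (λ c g x₁ x₂ a b c' da db →
        c :* ((g :* (x₂ :* (a :* b))) :+ (x₁ :* ((a :* c') :+ ((da :* b) :+ (a :* db)))))
        := ((g :* x₂) :* (c :* (a :* b))) :+ (x₁ :* ((c :* (a :* c')) :+ (c :* ((da :* b) :+ (a :* db)))))) ≋-refl

  F : ℕ → Poly
  F i = S (suc i) 1 ⊛ S (n ∸ i) (suc k)

  as-Pascal : Sum (λ i → c i ⊛ W i) n ≋ Sum (λ i → c i ⊛ (F (suc i) ⊕ F i)) n
  as-Pascal = Sum-cong n (λ i i<n → *-cong (≋-refl {c i}) (≋-trans (regroup i i<n)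
    (+-cong ≋-refl (≡⇒≋ (cong (λ z → U i ⊛ S z (suc k)) (pred-∸ n i i<n))))))

  step : S n (suc (suc k)) ≋ Conv n (suc (suc k)) → S n (suc k) ≋ Conv n (suc k) →
         S (suc n) (suc (suc k)) ≋ Conv (suc n) (suc (suc k))
  step hyp-B hyp-C = begin
      S (suc n) (suc (suc k))
    ≈⟨ S-recursion n (suc k) n (s≤s (ℕP.m∸n≤m m (suc k))) ⟩
      (γ ⊛ (X 2 ⊛ S n (suc (suc k)))) ⊕ (X 1 ⊛ (S n (suc k) ⊕ D n (S n (suc (suc k)))))
    ≈⟨ +-cong (*-cong ≋-refl (*-cong ≋-refl hyp-B)) (*-cong ≋-refl (+-cong hyp-C (≋-trans (D-cong n hyp-B) D-X₁ΣUV))) ⟩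
      (γ ⊛ (X 2 ⊛ (X 1 ⊛ ΣUV))) ⊕ (X 1 ⊛ ((X 1 ⊛ ΣUV') ⊕ ((X 2 ⊛ ΣUV) ⊕ (X 1 ⊛ ΣD))))
    ≈⟨ collect γ (X 1) (X 2) ΣUV ΣUV' ΣD ⟩
      X 1 ⊛ ((((γ ⊕ 1P) ⊛ X 2) ⊛ ΣUV) ⊕ (X 1 ⊛ (ΣUV' ⊕ ΣD)))
    ≈⟨ *-cong ≋-refl (≋-trans (≋-sym Sum-W) as-Pascal) ⟩
      X 1 ⊛ Sum (λ i → c i ⊛ (F (suc i) ⊕ F i)) n
    ≈⟨ *-cong ≋-refl (pascal-Sum m F) ⟩
      Conv (suc n) (suc (suc k))
    ∎
    where
      open ≋-Reasoning
      collect : ∀ g x₁ x₂ b c d →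
        (g ⊛ (x₂ ⊛ (x₁ ⊛ b))) ⊕ (x₁ ⊛ ((x₁ ⊛ c) ⊕ ((x₂ ⊛ b) ⊕ (x₁ ⊛ d))))
        ≋ x₁ ⊛ ((((g ⊕ 1P) ⊛ x₂) ⊛ b) ⊕ (x₁ ⊛ (c ⊕ d)))
      collect = solve 6 (λ g x₁ x₂ b c d →
        (g :* (x₂ :* (x₁ :* b))) :+ (x₁ :* ((x₁ :* c) :+ ((x₂ :* b) :+ (x₁ :* d))))
        := x₁ :* ((((g :+ con 1ℤ) :* x₂) :* b) :+ (x₁ :* (c :+ d)))) ≋-refl

S≋Conv : ∀ m k → S (suc m) (suc k) ≋ Conv (suc m) (suc k)
S≋Conv m zero = Conv-1 m
S≋Conv zero (suc k) rewrite S-vanish 1 (suc (suc k)) (s≤s (s≤s z≤n)) =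
  ≋-sym (≋-trans (*-cong ≋-refl (≋-trans (+-cong (≋-trans (*-cong ≋-refl (zeroʳ _)) (zeroʳ _)) ≋-refl) (+-identityˡ _))) (zeroʳ _))
S≋Conv (suc m) (suc k) = InductionStep.step m k (S≋Conv m (suc k)) (S≋Conv m k)

-- Beyond the range of (i) the terms of the convolution vanish:
-- S_{n-j,k-1} = 0 when j > n-k+1.
beyond-range : ∀ M k i → (M + suc k) ∸ suc (M + i) < suc k
beyond-range M k i rewrite sym (ℕP.+-suc M i) | ℕP.[m+n]∸[m+o]≡n∸o M (suc k) (suc i) = s≤s (ℕP.m∸n≤m k i)

part-i : (n k : ℕ) → 2 ≤ k → k ≤ n →
  S n k ≈ X 1 *P Σ[ 1 ⋯ n ∸ k + 1 ] (λ j → binom (n ∸ 1) (j ∸ 1) · (S j 1 *P S (n ∸ j) (k ∸ 1)))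
part-i (suc m) (suc (suc k)) (s≤s (s≤s z≤n)) k≤n = un (begin
    S n (suc (suc k))
  ≈⟨ S≋Conv m (suc k) ⟩
    X 1 ⊛ Sum ψ n
  ≡⟨ cong (λ z → X 1 ⊛ Sum ψ z) (sym n≡M+k) ⟩
    X 1 ⊛ Sum ψ (M + suc k)
  ≈⟨ *-cong ≋-refl (≋-trans (Sum-split M (suc k) ψ) (≋-trans (+-cong ≋-refl (Sum-0 (suc k) _ beyond)) (+-identityʳ _))) ⟩
    X 1 ⊛ Sum ψ M
  ≈⟨ *-cong ≋-refl (Sum-cong M (λ i _ → ≋-sym (summand i))) ⟩
    X 1 ⊛ Sum (λ i → f (suc i)) M
  ≡⟨ trans (cong (X 1 ⊛_) (sym (Σ≡Sum 1 M f))) (⊛-def _ _) ⟩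
    X 1 *P Σ[ 1 ⋯ M ] f
  ∎)
  where
    open ≋-Reasoning
    n M : ℕ
    n = suc m
    M = n ∸ suc (suc k) + 1
    n≡M+k : M + suc k ≡ n
    n≡M+k = trans (ℕP.+-assoc (n ∸ suc (suc k)) 1 (suc k)) (ℕP.m∸n+n≡m k≤n)
    f : ℕ → Poly
    f j = binom (n ∸ 1) (j ∸ 1) · (S j 1 *P S (n ∸ j) (suc k))
    ψ : ℕ → Poly
    ψ i = K (binom m i) ⊛ (S (suc i) 1 ⊛ S (n ∸ suc i) (suc k))
    summand : ∀ i → f (suc i) ≋ ψ i
    summand i = ≋-trans (·≋K⊛ (binom m i) _) (*-cong ≋-refl (≡⇒≋ (sym (⊛-def (S (suc i) 1) _))))
    beyond : ∀ i → i < suc k → ψ (M + i) ≋ 0P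
    beyond i _ rewrite S-vanish (n ∸ suc (M + i)) (suc k) (subst (λ z → z ∸ suc (M + i) < suc k) n≡M+k (beyond-range M k i)) =
      ≋-trans (*-cong ≋-refl (zeroʳ _)) (zeroʳ _)

sumℤ : (ℕ → ℤ) → ℕ → ℤ
sumℤ g zero = 0ℤ
sumℤ g (suc n) = g 0 +ℤ sumℤ (λ i → g (suc i)) n

sumℤ-cong : ∀ n {g h : ℕ → ℤ} → (∀ i → g i ≡ h i) → sumℤ g n ≡ sumℤ h n
sumℤ-cong zero e = refl
sumℤ-cong (suc n) e = cong₂ _+ℤ_ (e 0) (sumℤ-cong n (λ i → e (suc i)))

sumℤ-0 : ∀ n g → (∀ i → i < n → g i ≡ 0ℤ) → sumℤ g n ≡ 0ℤ
sumℤ-0 zero g h = refl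
sumℤ-0 (suc n) g h rewrite h 0 (s≤s z≤n) = trans (ℤP.+-identityˡ _) (sumℤ-0 n _ (λ i lt → h (suc i) (s≤s lt)))

sumℤ-single : ∀ n g y → y < n → (∀ i → i < n → i ≢ y → g i ≡ 0ℤ) → sumℤ g n ≡ g y
sumℤ-single (suc n) g zero lt h =
  trans (cong (g 0 +ℤ_) (sumℤ-0 n _ (λ i lt' → h (suc i) (s≤s lt') (λ ())))) (ℤP.+-identityʳ _)
sumℤ-single (suc n) g (suc y) (s≤s lt) h rewrite h 0 (s≤s z≤n) (λ ()) =
  trans (ℤP.+-identityˡ _) (sumℤ-single n _ y lt (λ i lt' ne → h (suc i) (s≤s lt') (λ e → ne (ℕP.suc-injective e))))

sumL-applyUpTo : ∀ (h : ℕ → ℕ) n (g : ℕ → ℤ) → sumL (applyUpTo h n) g ≡ sumℤ (λ i → g (h i)) n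
sumL-applyUpTo h zero g = refl
sumL-applyUpTo h (suc n) g = cong (g (h 0) +ℤ_) (sumL-applyUpTo (λ i → h (suc i)) n g)

sumL-filter : ∀ {A : Set} {ℓ} {P : Pred A ℓ} (P? : Decidable P) (l : List A) (f : A → ℤ) →
  sumL (filter P? l) f ≡ sumL l (λ x → if does (P? x) then f x else 0ℤ)
sumL-filter P? [] f = refl
sumL-filter P? (x ∷ l) f with does (P? x)
... | true = cong (f x +ℤ_) (sumL-filter P? l f)
... | false = trans (sumL-filter P? l f) (sym (ℤP.+-identityˡ _))

coeff-sumL : ∀ p m → coeff p m ≡ sumL p (λ t → if sameMono (proj₂ t) m then proj₁ t else 0ℤ)
coeff-sumL [] m = refl
coeff-sumL ((c , m') ∷ p) m = cong ((if sameMono m' m then c else 0ℤ) +ℤ_) (coeff-sumL p m)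

sumL-tuples : ∀ m b H → sumL (tuples (suc m) b) H ≡ sumℤ (λ x → sumL (tuples m b) (λ r → H (x ∷ r))) (suc b)
sumL-tuples m b H = trans (sumL-concatMap (λ x → map (x ∷_) (tuples m b)) (upTo (suc b)) H)
  (trans (sumL-applyUpTo (λ i → i) (suc b) (λ x → sumL (map (x ∷_) (tuples m b)) H))
           (sumℤ-cong (suc b) (λ x → sumL-map (x ∷_) (tuples m b) H)))

tuples-null : ∀ m b H → (∀ r → length r ≡ m → H r ≡ 0ℤ) → sumL (tuples m b) H ≡ 0ℤ
tuples-null zero b H h rewrite h [] refl = refl
tuples-null (suc m) b H h =
  trans (sumL-tuples m b H) (sumℤ-0 (suc b) _ (λ x _ → tuples-null m b _ (λ r e → h (x ∷ r) (cong suc e))))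

tuples-single : ∀ m b t H → length t ≡ m → All (_≤ b) t → (∀ r → length r ≡ m → r ≢ t → H r ≡ 0ℤ) →
  sumL (tuples m b) H ≡ H t
tuples-single zero b [] H e a h = ℤP.+-identityʳ _
tuples-single (suc m) b (y ∷ t) H e (y≤b ∷ a) h =
  trans (sumL-tuples m b H)
  (trans (sumℤ-single (suc b) _ y (s≤s y≤b)
             (λ x _ x≢y → tuples-null m b _ (λ r er → h (x ∷ r) (cong suc er) (λ eq → x≢y (LP.∷-injectiveˡ eq)))))
           (tuples-single m b t (λ r → H (y ∷ r)) (ℕP.suc-injective e) a
             (λ r er r≢t → h (y ∷ r) (cong suc er) (λ eq → r≢t (LP.∷-injectiveʳ eq)))))

sumN-cons0 : ∀ x l → sumN (cons0 x l) ≡ sumN (x ∷ l)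
sumN-cons0 zero [] = refl
sumN-cons0 zero (y ∷ l) = refl
sumN-cons0 (suc x) l = refl

wsum-cons0 : ∀ s x l → wsum s (cons0 x l) ≡ wsum s (x ∷ l)
wsum-cons0 s zero [] = sym (trans (ℕP.+-identityʳ (s * 0)) (ℕP.*-zeroʳ s))
wsum-cons0 s zero (y ∷ l) = refl
wsum-cons0 s (suc x) l = refl

denom-cons0 : ∀ s x l → denom s (cons0 x l) ≡ denom s (x ∷ l)
denom-cons0 s zero [] = refl
denom-cons0 s zero (y ∷ l) = refl
denom-cons0 s (suc x) l = refl

sumN-strip : ∀ xs → sumN (strip xs) ≡ sumN xs
sumN-strip [] = refl
sumN-strip (x ∷ xs) = trans (sumN-cons0 x (strip xs)) (cong (λ z → x + z) (sumN-strip xs))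

wsum-strip : ∀ s xs → wsum s (strip xs) ≡ wsum s xs
wsum-strip s [] = refl
wsum-strip s (x ∷ xs) = trans (wsum-cons0 s x (strip xs)) (cong (λ z → s * x + z) (wsum-strip (suc s) xs))

denom-strip : ∀ s xs → denom s (strip xs) ≡ denom s xs
denom-strip s [] = refl
denom-strip s (x ∷ xs) = trans (denom-cons0 s x (strip xs)) (cong ((x !) * ((s !) ^ x) *_) (denom-strip (suc s) xs))

sumN-via-strip : ∀ xs ys → strip xs ≡ strip ys → sumN xs ≡ sumN ys
sumN-via-strip xs ys e = trans (sym (sumN-strip xs)) (trans (cong sumN e) (sumN-strip ys))

wsum-via-strip : ∀ s xs ys → strip xs ≡ strip ys → wsum s xs ≡ wsum s ys
wsum-via-strip s xs ys e = trans (sym (wsum-strip s xs)) (trans (cong (wsum s) e) (wsum-strip s ys))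

denom-via-strip : ∀ s xs ys → strip xs ≡ strip ys → denom s xs ≡ denom s ys
denom-via-strip s xs ys e = trans (sym (denom-strip s xs)) (trans (cong (denom s) e) (denom-strip s ys))

strip-injective : ∀ xs ys → length xs ≡ length ys → strip xs ≡ strip ys → xs ≡ ys
strip-injective [] [] _ _ = refl
strip-injective (x ∷ xs) (y ∷ ys) el es =
  cong₂ _∷_ (strip-nth (x ∷ xs) (y ∷ ys) es 0)
            (strip-injective xs ys (ℕP.suc-injective el) (strip-ext xs ys (λ i → strip-nth (x ∷ xs) (y ∷ ys) es (suc i))))

sumN-zero : ∀ xs → sumN xs ≡ 0 → strip xs ≡ []
sumN-zero xs h = strip-ext xs [] (entries xs h)
  where entries : ∀ xs → sumN xs ≡ 0 → ∀ i → nth xs i ≡ 0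
        entries [] h i = refl
        entries (zero ∷ xs) h zero = refl
        entries (zero ∷ xs) h (suc i) = entries xs h i

pad : ℕ → List ℕ → List ℕ
pad zero xs = []
pad (suc m) [] = 0 ∷ pad m []
pad (suc m) (x ∷ xs) = x ∷ pad m xs

length-pad : ∀ m xs → length (pad m xs) ≡ m
length-pad zero xs = refl
length-pad (suc m) [] = cong suc (length-pad m [])
length-pad (suc m) (x ∷ xs) = cong suc (length-pad m xs)

nth-pad-< : ∀ m xs i → i < m → nth (pad m xs) i ≡ nth xs i
nth-pad-< (suc m) [] zero lt = refl
nth-pad-< (suc m) [] (suc i) (s≤s lt) = nth-pad-< m [] i lt
nth-pad-< (suc m) (x ∷ xs) zero lt = refl
nth-pad-< (suc m) (x ∷ xs) (suc i) (s≤s lt) = nth-pad-< m xs i lt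

nth-pad-≥ : ∀ m xs i → m ≤ i → nth (pad m xs) i ≡ 0
nth-pad-≥ zero xs i le = refl
nth-pad-≥ (suc m) [] (suc i) (s≤s le) = nth-pad-≥ m [] i le
nth-pad-≥ (suc m) (x ∷ xs) (suc i) (s≤s le) = nth-pad-≥ m xs i le

strip-pad : ∀ m xs → (∀ i → m ≤ i → nth xs i ≡ 0) → strip (pad m xs) ≡ strip xs
strip-pad m xs h = strip-ext (pad m xs) xs entries
  where entries : ∀ i → nth (pad m xs) i ≡ nth xs i
        entries i with i ℕP.<? m
        ... | yes lt = nth-pad-< m xs i lt
        ... | no nlt = trans (nth-pad-≥ m xs i (ℕP.≮⇒≥ nlt)) (sym (h i (ℕP.≮⇒≥ nlt)))

pad-bounded : ∀ m xs b → (∀ i → nth xs i ≤ b) → All (_≤ b) (pad m xs)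
pad-bounded zero xs b h = []
pad-bounded (suc m) [] b h = z≤n ∷ pad-bounded m [] b h
pad-bounded (suc m) (x ∷ xs) b h = h 0 ∷ pad-bounded m xs b (λ i → h (suc i))

nth≤sumN : ∀ xs i → nth xs i ≤ sumN xs
nth≤sumN [] i = z≤n
nth≤sumN (x ∷ xs) zero = ℕP.m≤m+n x _
nth≤sumN (x ∷ xs) (suc i) = ℕP.≤-trans (nth≤sumN xs i) (ℕP.m≤n+m _ x)

wsum-lower : ∀ s xs i → s * sumN xs + i * nth xs i ≤ wsum s xs
wsum-lower s [] i rewrite ℕP.*-zeroʳ i | ℕP.*-zeroʳ s = z≤n
wsum-lower s (x ∷ xs) zero rewrite ℕP.*-zeroˡ x | ℕP.+-identityʳ (s * (x + sumN xs)) | ℕP.*-distribˡ-+ s x (sumN xs) =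
  ℕP.+-monoʳ-≤ (s * x) (ℕP.≤-trans (ℕP.*-monoˡ-≤ (sumN xs) (ℕP.n≤1+n s))
                                   (ℕP.≤-trans (ℕP.≤-reflexive (sym (ℕP.+-identityʳ _))) (wsum-lower (suc s) xs 0)))
wsum-lower s (x ∷ xs) (suc i) =
  ℕP.≤-trans (ℕP.≤-reflexive (regroup s x (sumN xs) i (nth xs i)))
    (ℕP.+-monoʳ-≤ (s * x) (ℕP.≤-trans (ℕP.+-monoʳ-≤ (s * sumN xs) (ℕP.+-monoˡ-≤ (i * nth xs i) (nth≤sumN xs i)))
                                       (ℕP.≤-trans (ℕP.≤-reflexive (shift s (sumN xs) i (nth xs i))) (wsum-lower (suc s) xs i))))
  where
    regroup : ∀ s x S i n → s * (x + S) + suc i * n ≡ s * x + (s * S + (n + i * n))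
    regroup = solveℕ-∀
    shift : ∀ s S i n → s * S + (S + i * n) ≡ suc s * S + i * n
    shift = solveℕ-∀

support-bound : ∀ as n k → sumN as ≡ k → wsum 2 as ≡ n → ∀ i → n ∸ k ≤ i → nth as i ≡ 0
support-bound as n k e₁ e₂ i le with nth as i in eᵢ
... | zero = refl
... | suc a = ⊥-elim (ℕP.<⇒≱ (ℕP.m+n≤o⇒m≤o∸n (suc i) bound) le)
  where
    k≥1 : 1 ≤ k
    k≥1 = ℕP.≤-trans (s≤s z≤n) (ℕP.≤-trans (ℕP.≤-reflexive (sym eᵢ)) (ℕP.≤-trans (nth≤sumN as i) (ℕP.≤-reflexive e₁)))
    bound : suc i + k ≤ n
    bound = begin
      suc i + k             ≤⟨ ℕP.≤-reflexive (ℕP.+-comm (suc i) k) ⟩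
      k + suc i             ≤⟨ ℕP.+-monoʳ-≤ k (s≤s (ℕP.m≤m*n i (suc a))) ⟩
      k + suc (i * suc a)   ≤⟨ ℕP.≤-reflexive (ℕP.+-suc k _) ⟩
      suc k + i * suc a     ≤⟨ ℕP.+-monoˡ-≤ (i * suc a) (ℕP.≤-trans (ℕP.+-monoˡ-≤ k k≥1) (ℕP.≤-reflexive (cong (λ z → k + z) (sym (ℕP.+-identityʳ k))))) ⟩
      2 * k + i * suc a     ≤⟨ ℕP.≤-reflexive (cong₂ (λ x y → 2 * x + i * y) (sym e₁) (sym eᵢ)) ⟩
      2 * sumN as + i * nth as i ≤⟨ wsum-lower 2 as i ⟩
      wsum 2 as             ≡⟨ e₂ ⟩
      n                     ∎
      where open ℕP.≤-Reasoning

coeff-X₁:=0 : ∀ p as → coeff (X₁:=0 p) (0ℤ , as) ≡ coeff p (0ℤ , as)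
coeff-X₁:=0 [] as = refl
coeff-X₁:=0 ((c , (e , bs)) ∷ p) as with e ℤ.≟ 0ℤ
... | yes refl = cong ((if sameMono (0ℤ , bs) (0ℤ , as) then c else 0ℤ) +ℤ_) (coeff-X₁:=0 p as)
... | no _ = trans (coeff-X₁:=0 p as) (sym (ℤP.+-identityˡ _))

coeff-X₁:=0-X₁ : ∀ p e as → e ≢ 0ℤ → coeff (X₁:=0 p) (e , as) ≡ 0ℤ
coeff-X₁:=0-X₁ [] e as ne = refl
coeff-X₁:=0-X₁ ((c , (e' , bs)) ∷ p) e as ne with e' ℤ.≟ 0ℤ
... | yes refl rewrite sameMono-false (0ℤ , bs) (e , as) (λ h → ne (sym (~-exp {0ℤ} {e} {bs} {as} h))) =
  trans (ℤP.+-identityˡ _) (coeff-X₁:=0-X₁ p e as ne)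
... | no _ = coeff-X₁:=0-X₁ p e as ne

-- The coefficient of X₂^{a₀} X₃^{a₁} ⋯ in B̃_{n,k}: the multinomial number
-- n! / ∏ aᵢ! ((i+2)!)^{aᵢ} if Σ aᵢ = k and Σ (i+2)·aᵢ = n, and 0 otherwise.

Admissible : ℕ → ℕ → List ℕ → Set
Admissible n k as = sumN as ≡ k × wsum 2 as ≡ n

admissible? : ∀ n k as → Dec (Admissible n k as)
admissible? n k as = (sumN as ℕ.≟ k) ×-dec (wsum 2 as ℕ.≟ n)

bellCoeff : ℕ → ℕ → List ℕ → ℕ
bellCoeff n k as = if does (admissible? n k as) then divN (n !) (denom 2 as) else 0

bellCoeff-yes : ∀ {n k as} → Admissible n k as → bellCoeff n k as ≡ divN (n !) (denom 2 as)
bellCoeff-yes {n} {k} {as} adm rewrite dec-true (admissible? n k as) adm = refl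

bellCoeff-no : ∀ {n k as} → ¬ Admissible n k as → bellCoeff n k as ≡ 0
bellCoeff-no {n} {k} {as} ¬adm rewrite dec-false (admissible? n k as) ¬adm = refl

-- the weight of an exponent list is at least its degree
bellCoeff-below : ∀ n k as → n < k → bellCoeff n k as ≡ 0
bellCoeff-below n k as n<k = bellCoeff-no {n} {k} {as} λ { (e₁ , e₂) → ℕP.<⇒≱ n<k (begin
    k                  ≡⟨ sym e₁ ⟩
    sumN as            ≤⟨ ℕP.m≤m+n (sumN as) _ ⟩
    2 * sumN as        ≤⟨ ℕP.m≤m+n _ 0 ⟩
    2 * sumN as + 0 * nth as 0 ≤⟨ wsum-lower 2 as 0 ⟩
    wsum 2 as          ≡⟨ e₂ ⟩
    n                  ∎) }
  where open ℕP.≤-Reasoning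

coeff-B-0-0 : ∀ as → coeff (B 0 0) (0ℤ , as) ≡ + bellCoeff 0 0 as
coeff-B-0-0 as with strip as in empty
... | [] = cong +_ (sym (trans (bellCoeff-yes {0} {0} {as} (sumN-via-strip as [] empty , wsum-via-strip 2 as [] empty))
                                  (cong (divN 1) (denom-via-strip 2 as [] empty))))
... | y ∷ ys = cong +_ (sym (bellCoeff-no {0} {0} {as} λ { (e₁ , _) → nonempty (trans (sym empty) (sumN-zero as e₁)) }))
  where nonempty : y ∷ ys ≢ []
        nonempty ()

coeff-B-suc-0 : ∀ n as → coeff (B (suc n) 0) (0ℤ , as) ≡ + bellCoeff (suc n) 0 as
coeff-B-suc-0 n as = cong +_ (sym (bellCoeff-no {suc n} {0} {as} λ { (e₁ , e₂) → weightless (trans (sym e₂) (wsum-via-strip 2 as [] (sumN-zero as e₁))) }))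
  where weightless : suc n ≢ 0
        weightless ()

B-unfold : ∀ n k → suc k ≤ n → B n (suc k) ≡
  map (bellTerm n) (filter (λ r → (sumN r ℕ.≟ suc k) ×-dec (wsum 1 r ℕ.≟ n)) (tuples (n ∸ suc k + 1) (suc k)))
B-unfold (suc n) k k<n rewrite dec-true (suc k ℕ.≤? suc n) k<n = refl

B-vanish : ∀ n k → n < suc k → B n (suc k) ≡ 0P
B-vanish zero k _ = refl
B-vanish (suc n) k n<k rewrite dec-false (suc k ℕ.≤? suc n) (ℕP.<⇒≱ n<k) = refl

-- By
-- definition B_{n,k+1} has one term for each tuple r = (r₁, …, r_{n-k})
-- satisfying the two constraints; its coefficient is therefore a sum over
-- all tuples, to which only r = (0, a₀, a₁, …) can contribute.
module BellCoefficient (n k : ℕ) (as : List ℕ) where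

  L : ℕ
  L = n ∸ suc k

  P? : (r : List ℕ) → Dec (sumN r ≡ suc k × wsum 1 r ≡ n)
  P? r = (sumN r ℕ.≟ suc k) ×-dec (wsum 1 r ℕ.≟ n)

  contribution : List ℕ → ℤ
  contribution r =
    if does (P? r) then (if sameMono (proj₂ (bellTerm n r)) (0ℤ , as) then proj₁ (bellTerm n r) else 0ℤ) else 0ℤ

  coeff-as-sum : coeff (map (bellTerm n) (filter P? (tuples (n ∸ suc k + 1) (suc k)))) (0ℤ , as)
                 ≡ sumL (tuples (suc L) (suc k)) contribution
  coeff-as-sum =
    trans (coeff-sumL (map (bellTerm n) (filter P? (tuples (n ∸ suc k + 1) (suc k)))) (0ℤ , as))
    (trans (sumL-map (bellTerm n) (filter P? (tuples (n ∸ suc k + 1) (suc k))) coefficientAt)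
    (trans (sumL-filter P? (tuples (n ∸ suc k + 1) (suc k)) (λ r → coefficientAt (bellTerm n r)))
             (cong (λ l → sumL (tuples l (suc k)) contribution) (ℕP.+-comm L 1))))
    where coefficientAt : ℤ × Mono → ℤ
          coefficientAt t = if sameMono (proj₂ t) (0ℤ , as) then proj₁ t else 0ℤ

  contribution-other : ∀ r₁ rs → ¬ (+ r₁ , rs) ~ (0ℤ , as) → contribution (r₁ ∷ rs) ≡ 0ℤ
  contribution-other r₁ rs h rewrite sameMono-false (+ r₁ , rs) (0ℤ , as) h with does (P? (r₁ ∷ rs))
  ... | true = refl
  ... | false = refl

  contribution-rejected : ∀ r → ¬ (sumN r ≡ suc k × wsum 1 r ≡ n) → contribution r ≡ 0ℤ
  contribution-rejected r ¬P rewrite dec-false (P? r) ¬P = refl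

  P-shift : ∀ r₁ rs → r₁ ≡ 0 → strip rs ≡ strip as → sumN (r₁ ∷ rs) ≡ suc k × wsum 1 (r₁ ∷ rs) ≡ n →
            Admissible n (suc k) as
  P-shift .0 rs refl e (e₁ , e₂) =
    trans (sumN-via-strip as rs (sym e)) e₁ , trans (wsum-via-strip 2 as rs (sym e)) e₂

  contribution-inadmissible : ¬ Admissible n (suc k) as → ∀ r → length r ≡ suc L → contribution r ≡ 0ℤ
  contribution-inadmissible ¬adm (r₁ ∷ rs) _ = by-cases ((+ r₁ , rs) ~? (0ℤ , as))
    where
      by-cases : Dec ((+ r₁ , rs) ~ (0ℤ , as)) → contribution (r₁ ∷ rs) ≡ 0ℤ
      by-cases (no h) = contribution-other r₁ rs h
      by-cases (yes h) = contribution-rejected (r₁ ∷ rs)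
        (λ c → ¬adm (P-shift r₁ rs (ℤP.+-injective (cong proj₁ h)) (cong proj₂ h) c))

  module Admissible-case (adm : Admissible n (suc k) as) where

    t : List ℕ
    t = 0 ∷ pad L as

    strip-t : strip (pad L as) ≡ strip as
    strip-t = strip-pad L as (support-bound as n (suc k) (proj₁ adm) (proj₂ adm))

    contribution-t : contribution t ≡ + bellCoeff n (suc k) as
    contribution-t
      rewrite dec-true (P? t) (trans (sumN-via-strip (pad L as) as strip-t) (proj₁ adm) ,
                               trans (wsum-via-strip 2 (pad L as) as strip-t) (proj₂ adm))
            | sameMono-true (+ 0 , pad L as) (0ℤ , as) (cong (0ℤ ,_) strip-t)
            | bellCoeff-yes {n} {suc k} {as} adm
      = cong (λ d → + divN (n !) d) (trans (ℕP.+-identityʳ (denom 2 (pad L as))) (denom-via-strip 2 (pad L as) as strip-t))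

    contribution-unique : ∀ r → length r ≡ suc L → r ≢ t → contribution r ≡ 0ℤ
    contribution-unique (r₁ ∷ rs) len r≢t = by-cases ((+ r₁ , rs) ~? (0ℤ , as))
      where
        by-cases : Dec ((+ r₁ , rs) ~ (0ℤ , as)) → contribution (r₁ ∷ rs) ≡ 0ℤ
        by-cases (no h) = contribution-other r₁ rs h
        by-cases (yes h) = ⊥-elim (r≢t (cong₂ _∷_ (ℤP.+-injective (cong proj₁ h))
          (strip-injective rs (pad L as) (trans (ℕP.suc-injective len) (sym (length-pad L as)))
                           (trans (cong proj₂ h) (sym strip-t)))))

    t-bounded : All (_≤ suc k) t
    t-bounded = z≤n ∷ pad-bounded L as (suc k) (λ i → ℕP.≤-trans (nth≤sumN as i) (ℕP.≤-reflexive (proj₁ adm)))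

  coeff-B-suc : suc k ≤ n → coeff (B n (suc k)) (0ℤ , as) ≡ + bellCoeff n (suc k) as
  coeff-B-suc k<n = trans (cong (λ p → coeff p (0ℤ , as)) (B-unfold n k k<n))
                            (trans coeff-as-sum (sum-value (admissible? n (suc k) as)))
    where
      sum-value : Dec (Admissible n (suc k) as) → sumL (tuples (suc L) (suc k)) contribution ≡ + bellCoeff n (suc k) as
      sum-value (yes adm) = trans (tuples-single (suc L) (suc k) t contribution (cong suc (length-pad L as))
                                                   t-bounded contribution-unique) contribution-t
        where open Admissible-case adm
      sum-value (no ¬adm) = trans (tuples-null (suc L) (suc k) contribution (contribution-inadmissible ¬adm))
                                    (cong +_ (sym (bellCoeff-no {n} {suc k} {as} ¬adm)))

coeff-B : ∀ n k as → coeff (B n k) (0ℤ , as) ≡ + bellCoeff n k as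
coeff-B zero zero as = coeff-B-0-0 as
coeff-B (suc n) zero as = coeff-B-suc-0 n as
coeff-B n (suc k) as with suc k ℕ.≤? n
... | yes k<n = BellCoefficient.coeff-B-suc n k as k<n
... | no k≮n rewrite B-vanish n k (ℕP.≰⇒> k≮n) = cong +_ (sym (bellCoeff-below n (suc k) as (ℕP.≰⇒> k≮n)))

coeff-B̃ : ∀ n k as → coeff (B̃ n k) (0ℤ , as) ≡ + bellCoeff n k as
coeff-B̃ n k as = trans (coeff-X₁:=0 (B n k) as) (coeff-B n k as)

coeff-B̃-X₁ : ∀ n k e as → e ≢ 0ℤ → coeff (B̃ n k) (e , as) ≡ 0ℤ
coeff-B̃-X₁ n k e as = coeff-X₁:=0-X₁ (B n k) e as

-- The recursion of the multinomial numbers bellCoeff: removing one part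
-- i+2 from an exponent list of weight n+1,
--   (n+1)! / ∏  =  Σ_{i : aᵢ ≥ 1} C(n, i+1) · (n-i-1)! / ∏',
-- where ∏' is the denominator of the list with aᵢ decreased.  Multiplying by
-- ∏ = ∏' · aᵢ · (i+2)!, the i-th term becomes n!·(i+2)·aᵢ, and these add up
-- to n!·(n+1).  The divisibility of (weight)! by the denominator, needed to
-- cancel, is proved along the way by induction on the weight.

binom-factorials : ∀ {m r} → r ≤ m → (m C r) * (r ! * (m ∸ r) !) ≡ m !
binom-factorials {m} {r} le =
  trans (cong (_* (r ! * (m ∸ r) !)) (nCk≡n!/k![n-k]! le)) (m/n*n≡m {{ℕP._!*_!≢0 r (m ∸ r)}} (k![n∸k]!∣n! le))

sumℕ : (ℕ → ℕ) → ℕ → ℕ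
sumℕ f zero = 0
sumℕ f (suc n) = f 0 + sumℕ (λ i → f (suc i)) n

sumℕ-cong : ∀ N {f g : ℕ → ℕ} → (∀ i → i < N → f i ≡ g i) → sumℕ f N ≡ sumℕ g N
sumℕ-cong zero e = refl
sumℕ-cong (suc N) e = cong₂ _+_ (e 0 (s≤s z≤n)) (sumℕ-cong N (λ i lt → e (suc i) (s≤s lt)))

sumℕ-0 : ∀ N f → (∀ i → i < N → f i ≡ 0) → sumℕ f N ≡ 0
sumℕ-0 zero f e = refl
sumℕ-0 (suc N) f e rewrite e 0 (s≤s z≤n) = sumℕ-0 N _ (λ i lt → e (suc i) (s≤s lt))

sumℕ-*ˡ : ∀ N d f → d * sumℕ f N ≡ sumℕ (λ i → d * f i) N
sumℕ-*ˡ zero d f = ℕP.*-zeroʳ d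
sumℕ-*ˡ (suc N) d f = trans (ℕP.*-distribˡ-+ d (f 0) _) (cong (λ z → d * f 0 + z) (sumℕ-*ˡ N d _))

wsum-as-sum : ∀ s as N → (∀ i → N ≤ i → nth as i ≡ 0) → sumℕ (λ i → (s + i) * nth as i) N ≡ wsum s as
wsum-as-sum s [] N h = sumℕ-0 N _ (λ i _ → ℕP.*-zeroʳ (s + i))
wsum-as-sum s (x ∷ as) zero h = sym (wsum-via-strip s (x ∷ as) [] (strip-ext (x ∷ as) [] (λ i → h i z≤n)))
wsum-as-sum s (x ∷ as) (suc N) h =
  cong₂ _+_ (cong (_* x) (ℕP.+-identityʳ s))
    (trans (sumℕ-cong N (λ i _ → cong (_* nth as i) (ℕP.+-suc s i))) (wsum-as-sum (suc s) as N (λ i le → h (suc i) (s≤s le))))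

sumN-decAt : ∀ as i → 1 ≤ nth as i → sumN (decAt as i) + 1 ≡ sumN as
sumN-decAt (suc x ∷ as) zero _ = ℕP.+-comm (x + sumN as) 1
sumN-decAt (x ∷ as) (suc i) le = trans (ℕP.+-assoc x (sumN (decAt as i)) 1) (cong (λ z → x + z) (sumN-decAt as i le))

wsum-decAt : ∀ s as i → 1 ≤ nth as i → wsum s (decAt as i) + (s + i) ≡ wsum s as
wsum-decAt s (suc x ∷ as) zero _ = rearrange s x (wsum (suc s) as)
  where rearrange : ∀ s x w → s * x + w + (s + 0) ≡ s * suc x + w
        rearrange = solveℕ-∀
wsum-decAt s (x ∷ as) (suc i) le =
  trans (rearrange s x (wsum (suc s) (decAt as i)) i) (cong (λ z → s * x + z) (wsum-decAt (suc s) as i le))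
  where rearrange : ∀ s x w i → s * x + w + (s + suc i) ≡ s * x + (w + (suc s + i))
        rearrange = solveℕ-∀

denom-decAt : ∀ s as i → 1 ≤ nth as i → denom s as ≡ denom s (decAt as i) * (nth as i * (s + i) !)
denom-decAt s (suc x ∷ as) zero _ rewrite ℕP.+-identityʳ s = rearrange (x !) (s !) ((s !) ^ x) (denom (suc s) as) x
  where rearrange : ∀ xf sf p d x → (suc x * xf) * (sf * p) * d ≡ xf * p * d * (suc x * sf)
        rearrange = solveℕ-∀
denom-decAt s (x ∷ as) (suc i) le rewrite denom-decAt (suc s) as i le | ℕP.+-suc s i =
  sym (ℕP.*-assoc ((x !) * ((s !) ^ x)) (denom (suc s) (decAt as i)) _)

denom-positive : ∀ s as → 1 ≤ denom s as
denom-positive s [] = ℕP.≤-refl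
denom-positive s (x ∷ as) = ℕP.*-mono-≤ (ℕP.*-mono-≤ (ℕP.1≤n! x) (power-positive (s !) x (ℕP.1≤n! s))) (denom-positive (suc s) as)
  where power-positive : ∀ b e → 1 ≤ b → 1 ≤ b ^ e
        power-positive b zero _ = ℕP.≤-refl
        power-positive b (suc e) h = ℕP.*-mono-≤ h (power-positive b e h)

divN-cancel : ∀ x d → 1 ≤ d → divN (x * d) d ≡ x
divN-cancel x (suc d) _ = m*n/n≡m x (suc d)

∸-intro : ∀ a b c → a + b ≡ c → a ≡ c ∸ b
∸-intro a b c e = trans (sym (ℕP.m+n∸n≡m a b)) (cong (_∸ b) e)

whenPositive : ℕ → ℕ → ℕ
whenPositive zero v = 0
whenPositive (suc _) v = v

recTerm : ℕ → List ℕ → ℕ → ℕ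
recTerm n as i = (n C suc i) * whenPositive (nth as i) (divN ((n ∸ suc i) !) (denom 2 (decAt as i)))

FactorialDivisible : List ℕ → Set
FactorialDivisible as = divN ((wsum 2 as) !) (denom 2 as) * denom 2 as ≡ (wsum 2 as) !

scaled-recTerm : ∀ n as i → wsum 2 as ≡ suc n → (1 ≤ nth as i → FactorialDivisible (decAt as i)) →
  denom 2 as * recTerm n as i ≡ n ! * ((2 + i) * nth as i)
scaled-recTerm n as i ew divisible with nth as i in ea
... | zero rewrite ℕP.*-zeroʳ (n C suc i) | ℕP.*-zeroʳ (denom 2 as) | ℕP.*-zeroʳ (2 + i) | ℕP.*-zeroʳ (n !) = refl
... | suc a = begin
    denom 2 as * ((n C suc i) * q)
  ≡⟨ cong (_* ((n C suc i) * q)) (trans (denom-decAt 2 as i a≥1) (cong (λ z → D' * (z * (2 + i) !)) ea)) ⟩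
    D' * (suc a * ((2 + i) * (suc i) !)) * ((n C suc i) * q)
  ≡⟨ rearrange D' a i ((suc i) !) (n C suc i) q ⟩
    (n C suc i) * ((suc i) ! * (q * D')) * ((2 + i) * suc a)
  ≡⟨ cong (λ z → (n C suc i) * ((suc i) ! * z) * ((2 + i) * suc a)) quotient ⟩
    (n C suc i) * ((suc i) ! * (n ∸ suc i) !) * ((2 + i) * suc a)
  ≡⟨ cong (_* ((2 + i) * suc a)) (binom-factorials i<n) ⟩
    n ! * ((2 + i) * suc a)
  ∎
  where
    open ≡.≡-Reasoning
    a≥1 : 1 ≤ nth as i
    a≥1 = subst (1 ≤_) (sym ea) (s≤s z≤n)
    D' q : ℕ
    D' = denom 2 (decAt as i)
    q = divN ((n ∸ suc i) !) D'
    weight : wsum 2 (decAt as i) + (2 + i) ≡ suc n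
    weight = trans (wsum-decAt 2 as i a≥1) ew
    quotient : q * D' ≡ (n ∸ suc i) !
    quotient = subst (λ z → divN (z !) D' * D' ≡ z !) (∸-intro _ (2 + i) (suc n) weight) (divisible (s≤s z≤n))
    i<n : suc i ≤ n
    i<n = ℕP.≤-pred (ℕP.≤-trans (ℕP.m≤n+m (2 + i) (wsum 2 (decAt as i))) (ℕP.≤-reflexive weight))
    rearrange : ∀ D' a i F C q → D' * (suc a * ((2 + i) * F)) * (C * q) ≡ C * (F * (q * D')) * ((2 + i) * suc a)
    rearrange = solveℕ-∀

scaled-recSum : ∀ n as N → wsum 2 as ≡ suc n → (∀ i → N ≤ i → nth as i ≡ 0) →
  (∀ i → 1 ≤ nth as i → FactorialDivisible (decAt as i)) → denom 2 as * sumℕ (recTerm n as) N ≡ (suc n) !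
scaled-recSum n as N ew support divisible = begin
    denom 2 as * sumℕ (recTerm n as) N
  ≡⟨ sumℕ-*ˡ N (denom 2 as) (recTerm n as) ⟩
    sumℕ (λ i → denom 2 as * recTerm n as i) N
  ≡⟨ sumℕ-cong N (λ i _ → scaled-recTerm n as i ew (divisible i)) ⟩
    sumℕ (λ i → n ! * ((2 + i) * nth as i)) N
  ≡⟨ sym (sumℕ-*ˡ N (n !) (λ i → (2 + i) * nth as i)) ⟩
    n ! * sumℕ (λ i → (2 + i) * nth as i) N
  ≡⟨ cong (n ! *_) (trans (wsum-as-sum 2 as N support) ew) ⟩
    n ! * suc n
  ≡⟨ ℕP.*-comm (n !) (suc n) ⟩
    (suc n) !
  ∎
  where open ≡.≡-Reasoning

weight-zero : ∀ as → wsum 2 as ≡ 0 → sumN as ≡ 0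
weight-zero as w = ℕP.n≤0⇒n≡0 (begin
    sumN as                     ≤⟨ ℕP.m≤m+n (sumN as) _ ⟩
    2 * sumN as                 ≤⟨ ℕP.m≤m+n _ 0 ⟩
    2 * sumN as + 0 * nth as 0  ≤⟨ wsum-lower 2 as 0 ⟩
    wsum 2 as                   ≡⟨ w ⟩
    0                           ∎)
  where open ℕP.≤-Reasoning

divisible-step : ∀ n as → wsum 2 as ≡ suc n → (∀ i → 1 ≤ nth as i → FactorialDivisible (decAt as i)) →
  divN ((suc n) !) (denom 2 as) * denom 2 as ≡ (suc n) !
divisible-step n as ew smaller = begin
    divN ((suc n) !) d * d      ≡⟨ cong (λ z → divN z d * d) (sym scaled) ⟩
    divN (d * s) d * d          ≡⟨ cong (λ z → divN z d * d) (ℕP.*-comm d s) ⟩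
    divN (s * d) d * d          ≡⟨ cong (_* d) (divN-cancel s d (denom-positive 2 as)) ⟩
    s * d                       ≡⟨ ℕP.*-comm s d ⟩
    d * s                       ≡⟨ scaled ⟩
    (suc n) !                   ∎
  where
    open ≡.≡-Reasoning
    d s : ℕ
    d = denom 2 as
    s = sumℕ (recTerm n as) (length as)
    scaled : d * s ≡ (suc n) !
    scaled = scaled-recSum n as (length as) ew (nth-beyond as) smaller

-- Removing a part lowers the weight, which makes the induction work.
decAt-lighter : ∀ as i n w → 1 ≤ nth as i → wsum 2 as ≡ suc n → n ≤ w → wsum 2 (decAt as i) ≤ w
decAt-lighter as i n w a≥1 ew n≤w = ℕP.≤-pred (begin
    suc (wsum 2 (decAt as i))          ≤⟨ s≤s (ℕP.m≤m+n _ (suc i)) ⟩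
    suc (wsum 2 (decAt as i) + suc i)  ≡⟨ sym (ℕP.+-suc (wsum 2 (decAt as i)) (suc i)) ⟩
    wsum 2 (decAt as i) + (2 + i)      ≡⟨ trans (wsum-decAt 2 as i a≥1) ew ⟩
    suc n                              ≤⟨ s≤s n≤w ⟩
    suc w                              ∎)
  where open ℕP.≤-Reasoning

factorial-divisible : ∀ w as → wsum 2 as ≤ w → FactorialDivisible as
factorial-divisible w as le with wsum 2 as in ew
... | zero rewrite denom-via-strip 2 as [] (sumN-zero as (weight-zero as ew)) = refl
... | suc n with le
...   | s≤s {n = w'} n≤w' = divisible-step n as ew
          (λ i a≥1 → factorial-divisible w' (decAt as i) (decAt-lighter as i n w' a≥1 ew n≤w'))

multinomial-recursion : ∀ n as N → wsum 2 as ≡ suc n → (∀ i → N ≤ i → nth as i ≡ 0) →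
  divN ((suc n) !) (denom 2 as) ≡ sumℕ (recTerm n as) N
multinomial-recursion n as N ew support = begin
    divN ((suc n) !) (denom 2 as)
  ≡⟨ cong (λ z → divN z (denom 2 as)) (sym scaled) ⟩
    divN (denom 2 as * sumℕ (recTerm n as) N) (denom 2 as)
  ≡⟨ cong (λ z → divN z (denom 2 as)) (ℕP.*-comm (denom 2 as) _) ⟩
    divN (sumℕ (recTerm n as) N * denom 2 as) (denom 2 as)
  ≡⟨ divN-cancel _ (denom 2 as) (denom-positive 2 as) ⟩
    sumℕ (recTerm n as) N
  ∎
  where
    open ≡.≡-Reasoning
    scaled = scaled-recSum n as N ew support (λ i _ → factorial-divisible (wsum 2 (decAt as i)) (decAt as i) ℕP.≤-refl)

decAt-admissible : ∀ n k as i → 1 ≤ nth as i → Admissible (suc n) (suc k) as → Admissible (n ∸ suc i) k (decAt as i)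
decAt-admissible n k as i a≥1 (e₁ , e₂) =
  ℕP.+-cancelʳ-≡ 1 (sumN (decAt as i)) k (trans (sumN-decAt as i a≥1) (trans e₁ (ℕP.+-comm 1 k))) ,
  ∸-intro _ (2 + i) (suc n) (trans (wsum-decAt 2 as i a≥1) e₂)

decAt-admissible⁻ : ∀ n k as i → 1 ≤ nth as i → suc i ≤ n → Admissible (n ∸ suc i) k (decAt as i) → Admissible (suc n) (suc k) as
decAt-admissible⁻ n k as i a≥1 i<n (e₁ , e₂) =
  trans (sym (sumN-decAt as i a≥1)) (trans (cong (_+ 1) e₁) (ℕP.+-comm k 1)) ,
  trans (sym (wsum-decAt 2 as i a≥1)) (trans (cong (_+ (2 + i)) e₂)
    (trans (ℕP.+-suc (n ∸ suc i) (suc i)) (cong suc (ℕP.m∸n+n≡m i<n))))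

bellRecTerm : ℕ → ℕ → List ℕ → ℕ → ℕ
bellRecTerm n k as i = (n C suc i) * whenPositive (nth as i) (bellCoeff (n ∸ suc i) k (decAt as i))

bellCoeff-recursion : ∀ n k as → k ≤ n → bellCoeff (suc n) (suc k) as ≡ sumℕ (bellRecTerm n k as) (n ∸ k)
bellCoeff-recursion n k as k≤n with admissible? (suc n) (suc k) as
... | yes adm = trans (bellCoeff-yes {suc n} {suc k} {as} adm)
                (trans (multinomial-recursion n as (n ∸ k) (proj₂ adm) (support-bound as (suc n) (suc k) (proj₁ adm) (proj₂ adm)))
                         (sumℕ-cong (n ∸ k) term))
  where
    term : ∀ i → i < n ∸ k → recTerm n as i ≡ bellRecTerm n k as i
    term i _ with nth as i in ea
    ... | zero = refl
    ... | suc a = cong ((n C suc i) *_) (sym (bellCoeff-yes {n ∸ suc i} {k} {decAt as i}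
                    (decAt-admissible n k as i (subst (1 ≤_) (sym ea) (s≤s z≤n)) adm)))
... | no ¬adm = trans (bellCoeff-no {suc n} {suc k} {as} ¬adm) (sym (sumℕ-0 (n ∸ k) _ term))
  where
    term : ∀ i → i < n ∸ k → bellRecTerm n k as i ≡ 0
    term i i<n-k with nth as i in ea
    ... | zero = ℕP.*-zeroʳ (n C suc i)
    ... | suc a = trans (cong ((n C suc i) *_) (bellCoeff-no {n ∸ suc i} {k} {decAt as i}
                    (λ adm' → ¬adm (decAt-admissible⁻ n k as i a≥1 (ℕP.≤-trans i<n-k (ℕP.m∸n≤m n k)) adm'))))
                  (ℕP.*-zeroʳ (n C suc i))
      where a≥1 : 1 ≤ nth as i
            a≥1 = subst (1 ≤_) (sym ea) (s≤s z≤n)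

unitExp : ℕ → List ℕ
unitExp i = replicate i 0 ++ (1 ∷ [])

nth-unitExp-same : ∀ i → nth (unitExp i) i ≡ 1
nth-unitExp-same zero = refl
nth-unitExp-same (suc i) = nth-unitExp-same i

nth-unitExp-other : ∀ i j → i ≢ j → nth (unitExp i) j ≡ 0
nth-unitExp-other zero zero ne = ⊥-elim (ne refl)
nth-unitExp-other zero (suc j) ne = refl
nth-unitExp-other (suc i) zero ne = refl
nth-unitExp-other (suc i) (suc j) ne = nth-unitExp-other i j (λ e → ne (cong suc e))

δ-iff : ∀ m x m' x' → (x ~ m → x' ~ m') → (x' ~ m' → x ~ m) → δ m x ≡ δ m' x'
δ-iff m x m' x' to from with x ~? m | x' ~? m'
... | yes h | yes h' = refl
... | no h | no h' = refl
... | yes h | no h' = ⊥-elim (h' (to h))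
... | no h | yes h' = ⊥-elim (h (from h'))

module _ (i : ℕ) (e : ℤ) (as : List ℕ) where

  coeff-X*P : ∀ p → coeff (X (suc (suc i)) *P p) (e , as) ≡ pairing p (λ m → δ (e , as) (mulMono (0ℤ , unitExp i) m))
  coeff-X*P p = trans (coeff-*P (X (suc (suc i))) p (e , as)) (trans (ℤP.+-identityʳ _) (ℤP.*-identityˡ _))

  X*-exponent : ∀ f bs → (0ℤ +ℤ f , addExp (unitExp i) bs) ~ (e , as) → nth as i ≢ 0
  X*-exponent f bs h a≡0 with trans (sym (cong (_+ nth bs i) (nth-unitExp-same i)))
                               (trans (sym (nth-addExp (unitExp i) bs i)) (trans (~-nth {0ℤ +ℤ f} {e} {addExp (unitExp i) bs} {as} h i) a≡0))
  ... | ()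

  coeff-X*P-absent : ∀ p → nth as i ≡ 0 → coeff (X (suc (suc i)) *P p) (e , as) ≡ 0ℤ
  coeff-X*P-absent p a≡0 = trans (coeff-X*P p) (trans (pairing-cong p vanish) (pairing-0 p))
    where
      vanish : ∀ m → δ (e , as) (mulMono (0ℤ , unitExp i) m) ≡ 0ℤ
      vanish (f , bs) rewrite sameMono-false (0ℤ +ℤ f , addExp (unitExp i) bs) (e , as) (λ h → X*-exponent f bs h a≡0) = refl

  module _ (a≥1 : 1 ≤ nth as i) where

    divide-by-X : ∀ f bs → (0ℤ +ℤ f , addExp (unitExp i) bs) ~ (e , as) → (f , bs) ~ (e , decAt as i)
    divide-by-X f bs h = ~-intro f e bs (decAt as i) (trans (sym (ℤP.+-identityˡ f)) (~-exp {0ℤ +ℤ f} {e} {addExp (unitExp i) bs} {as} h)) entries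
      where
        entry = ~-nth {0ℤ +ℤ f} {e} {addExp (unitExp i) bs} {as} h
        entries : ∀ j → nth bs j ≡ nth (decAt as i) j
        entries j with i ℕ.≟ j
        ... | yes refl = sym (trans (nth-decAt-same as i) (cong (_∸ 1) (trans (sym (entry i))
                           (trans (nth-addExp (unitExp i) bs i) (cong (_+ nth bs i) (nth-unitExp-same i))))))
        ... | no i≢j = sym (trans (nth-decAt-other as i j i≢j) (trans (sym (entry j))
                         (trans (nth-addExp (unitExp i) bs j) (cong (_+ nth bs j) (nth-unitExp-other i j i≢j)))))

    multiply-by-X : ∀ f bs → (f , bs) ~ (e , decAt as i) → (0ℤ +ℤ f , addExp (unitExp i) bs) ~ (e , as)
    multiply-by-X f bs h = ~-intro (0ℤ +ℤ f) e (addExp (unitExp i) bs) as (trans (ℤP.+-identityˡ f) (~-exp {f} {e} {bs} {decAt as i} h)) entries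
      where
        entry = ~-nth {f} {e} {bs} {decAt as i} h
        entries : ∀ j → nth (addExp (unitExp i) bs) j ≡ nth as j
        entries j with i ℕ.≟ j
        ... | yes refl = trans (nth-addExp (unitExp i) bs i)
                           (trans (cong₂ _+_ (nth-unitExp-same i) (trans (entry i) (nth-decAt-same as i))) (ℕP.m+[n∸m]≡n a≥1))
        ... | no i≢j = trans (nth-addExp (unitExp i) bs j)
                         (trans (cong₂ _+_ (nth-unitExp-other i j i≢j) (entry j)) (nth-decAt-other as i j i≢j))

    coeff-X*P-present : ∀ p → coeff (X (suc (suc i)) *P p) (e , as) ≡ coeff p (e , decAt as i)
    coeff-X*P-present p = trans (coeff-X*P p) (trans (pairing-cong p shifted) (sym (coeff-pairing p (e , decAt as i))))
      where
        shifted : ∀ m → δ (e , as) (mulMono (0ℤ , unitExp i) m) ≡ δ (e , decAt as i) m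
        shifted (f , bs) = δ-iff (e , as) (0ℤ +ℤ f , addExp (unitExp i) bs) (e , decAt as i) (f , bs)
                                 (divide-by-X f bs) (multiply-by-X f bs)

coeff-Sum : ∀ N φ m → coeff (Sum φ N) m ≡ sumℤ (λ i → coeff (φ i) m) N
coeff-Sum zero φ m = refl
coeff-Sum (suc N) φ m = trans (cong (λ z → coeff z m) (⊕-def (φ 0) (Sum (λ i → φ (suc i)) N)))
  (trans (coeff-++ (φ 0) _ m) (cong (coeff (φ 0) m +ℤ_) (coeff-Sum N (λ i → φ (suc i)) m)))

sumℤ-pos : ∀ N f → sumℤ (λ i → + f i) N ≡ + sumℕ f N
sumℤ-pos zero f = refl
sumℤ-pos (suc N) f = trans (cong (+ f 0 +ℤ_) (sumℤ-pos N (λ i → f (suc i)))) (sym (ℤP.pos-+ (f 0) _))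

-- The right-hand side of (ii) for (n+1, k+1), with j = i+2.
module RightHandSide (n k : ℕ) where

  summand : ℕ → Poly
  summand j = binom (suc n ∸ 1) (j ∸ 1) · (X j *P B̃ (suc n ∸ j) (suc k ∸ 1))

  coeff-Σ : ∀ m → coeff (Σ[ 2 ⋯ suc n ∸ suc k + 1 ] summand) m ≡ sumℤ (λ i → coeff (summand (2 + i)) m) (n ∸ k)
  coeff-Σ m = trans (cong (λ z → coeff z m) (Σ≡Sum 2 (n ∸ k + 1) summand))
    (trans (coeff-Sum (suc (n ∸ k + 1) ∸ 2) (λ i → summand (2 + i)) m)
             (cong (sumℤ (λ i → coeff (summand (2 + i)) m)) (ℕP.m+n∸n≡m (n ∸ k) 1)))

  coeff-summand : ∀ i e as → coeff (summand (2 + i)) (e , as) ≡ binom n (suc i) *ℤ coeff (X (2 + i) *P B̃ (n ∸ suc i) k) (e , as)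
  coeff-summand i e as = coeff-· (binom n (suc i)) (X (2 + i) *P B̃ (n ∸ suc i) k) (e , as)

  coeff-summand-free : ∀ i as → coeff (summand (2 + i)) (0ℤ , as) ≡ + bellRecTerm n k as i
  coeff-summand-free i as with nth as i in ea
  ... | zero = trans (coeff-summand i 0ℤ as)
                 (trans (cong (binom n (suc i) *ℤ_) (coeff-X*P-absent i 0ℤ as (B̃ (n ∸ suc i) k) ea))
                          (trans (ℤP.*-zeroʳ (binom n (suc i))) (cong +_ (sym (ℕP.*-zeroʳ (n C suc i))))))
  ... | suc a = trans (coeff-summand i 0ℤ as)
                  (trans (cong (binom n (suc i) *ℤ_)
                             (trans (coeff-X*P-present i 0ℤ as (subst (1 ≤_) (sym ea) (s≤s z≤n)) (B̃ (n ∸ suc i) k))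
                                      (coeff-B̃ (n ∸ suc i) k (decAt as i))))
                           (sym (ℤP.pos-* (n C suc i) _)))

  coeff-summand-X₁ : ∀ i e as → e ≢ 0ℤ → coeff (summand (2 + i)) (e , as) ≡ 0ℤ
  coeff-summand-X₁ i e as e≢0 with nth as i in ea
  ... | zero = trans (coeff-summand i e as)
                 (trans (cong (binom n (suc i) *ℤ_) (coeff-X*P-absent i e as (B̃ (n ∸ suc i) k) ea)) (ℤP.*-zeroʳ (binom n (suc i))))
  ... | suc a = trans (coeff-summand i e as)
                  (trans (cong (binom n (suc i) *ℤ_)
                             (trans (coeff-X*P-present i e as (subst (1 ≤_) (sym ea) (s≤s z≤n)) (B̃ (n ∸ suc i) k))
                                      (coeff-B̃-X₁ (n ∸ suc i) k e (decAt as i) e≢0)))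
                           (ℤP.*-zeroʳ (binom n (suc i))))

-- Part (ii): compare coefficients; monomials involving X₁ occur on neither
-- side, and at the others (ii) is the recursion of bellCoeff.
part-ii : (n k : ℕ) → 1 ≤ k → k ≤ n →
  B̃ n k ≈ Σ[ 2 ⋯ n ∸ k + 1 ] (λ j → binom (n ∸ 1) (j ∸ 1) · (X j *P B̃ (n ∸ j) (k ∸ 1)))
part-ii (suc n) (suc k) _ (s≤s k≤n) (e , as) with e ℤ.≟ 0ℤ
... | yes refl = begin
    coeff (B̃ (suc n) (suc k)) (0ℤ , as)                  ≡⟨ coeff-B̃ (suc n) (suc k) as ⟩
    + bellCoeff (suc n) (suc k) as                         ≡⟨ cong +_ (bellCoeff-recursion n k as k≤n) ⟩
    + sumℕ (bellRecTerm n k as) (n ∸ k)                    ≡⟨ sym (sumℤ-pos (n ∸ k) (bellRecTerm n k as)) ⟩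
    sumℤ (λ i → + bellRecTerm n k as i) (n ∸ k)            ≡⟨ sumℤ-cong (n ∸ k) (λ i → sym (coeff-summand-free i as)) ⟩
    sumℤ (λ i → coeff (summand (2 + i)) (0ℤ , as)) (n ∸ k) ≡⟨ sym (coeff-Σ (0ℤ , as)) ⟩
    coeff (Σ[ 2 ⋯ suc n ∸ suc k + 1 ] summand) (0ℤ , as)   ∎
  where open ≡.≡-Reasoning
        open RightHandSide n k
... | no e≢0 = trans (coeff-B̃-X₁ (suc n) (suc k) e as e≢0)
                 (sym (trans (coeff-Σ (e , as)) (sumℤ-0 (n ∸ k) _ (λ i _ → coeff-summand-X₁ i e as e≢0))))
  where open RightHandSide n k

corollary5p6 :
    ((n k : ℕ) → 2 ≤ k → k ≤ n →
      S n k ≈ X 1 *P Σ[ 1 ⋯ n ∸ k + 1 ] (λ j → binom (n ∸ 1) (j ∸ 1) · (S j 1 *P S (n ∸ j) (k ∸ 1))))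
    ×
    ((n k : ℕ) → 1 ≤ k → k ≤ n →
      B̃ n k ≈ Σ[ 2 ⋯ n ∸ k + 1 ] (λ j → binom (n ∸ 1) (j ∸ 1) · (X j *P B̃ (n ∸ j) (k ∸ 1))))
corollary5p6 = part-i , part-ii
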